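{- Let $G$ be a finite graph and $\mathcal L$ a non-trivial linear class of bonds of $G$. Then the bases of the join matroid $J(G,\mathcal L)$ are exactly the edge sets of forests $F$ of $G$ for which $\mathrm{Ext}(\pi_F)$ is a bond not belonging to $\mathcal L$.
   Context: Graphs are finite, loops and multiple edges allowed. A bond is a minimal nonempty edge cut; $\delta(X)$ is the set of links with exactly one endpoint in $X\subseteq V(G)$. A tribond is $\delta(X_1)\cup\delta(X_2)\cup\delta(X_3)$ for a partition $\{X_1,X_2,X_3\}$ of the vertex set of one connected component into nonempty sets with each $G[X_i]$ connected and an edge joining each pair. A linear class of bonds is a set $\mathcal L$ of bonds such that for each such tripartition the number of $i$ with $\delta(X_i)\in\mathcal L$ is never exactly two; it is trivial if it contains every bond. A modular pair of bonds $B_1,B_2$ is one for which $G-(B_1\cup B_2)$ has two more components than $G$; a dibond is the union of a modular pair that is not a tribond. For non-trivial $\mathcal L$, $J_0(G,\mathcal L)$ is the matroid on $E(G)\cup\{e_0\}$ whose cocircuits are the bonds in $\mathcal L$, the sets $B\cup\{e_0\}$ for bonds $B\notin\mathcal L$, and the tribonds and dibonds containing no bond of $\mathcal L$; and $J(G,\mathcal L)=J_0(G,\mathcal L)/e_0$. For $F\subseteq E(G)$, $\pi_F$ is the partition of $V(G)$ into vertex sets of the components of $(V(G),F)$, and $\mathrm{Ext}(\pi)$ is the set of edges of $G$ whose endpoints lie in different parts of $\pi$. -}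

module Defs where

open import Data.Nat using (ℕ; suc; _+_)
open import Data.Fin using (Fin)
open import Data.Fin.Subset
  using (Subset; _∈_; _∉_; _⊆_; ∁; _∪_; _∩_; ⊤; ⊥; Nonempty; inside; outside)
open import Data.Vec using (Vec; _∷_; tabulate)
open import Data.Bool using (Bool; true; false; _xor_)
open import Data.Product using (Σ; ∃; _×_; _,_; proj₁; proj₂)
open import Data.Sum using (_⊎_)
open import Relation.Nullary using (¬_; does)
open import Relation.Binary.PropositionalEquality using (_≡_)
open import Data.Fin.Subset.Properties using (_∈?_)

-- Finite graphs with loops and multiple edges allowed.
-- Vertices are Fin nV, edges are Fin nE, each edge has two ends
-- (equal ends = loop).

record Graph : Set where
  field
    nV   : ℕ
    nE   : ℕ
    src  : Fin nE → Fin nV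
    tgt  : Fin nE → Fin nV

open Graph public

module _ (G : Graph) where

  VSet = Subset (nV G)
  ESet = Subset (nE G)

  δ : VSet → ESet
  δ X = tabulate λ e → does (src G e ∈? X) xor does (tgt G e ∈? X)

  Adj : ESet → VSet → Fin (nV G) → Fin (nV G) → Set
  Adj F X a b = ∃ λ e → e ∈ F × a ∈ X × b ∈ X ×
    ((src G e ≡ a × tgt G e ≡ b) ⊎ (src G e ≡ b × tgt G e ≡ a))

  data Reach (F : ESet) (X : VSet) (u : Fin (nV G)) : Fin (nV G) → Set where
    here : u ∈ X → Reach F X u u
    step : ∀ {a b} → Reach F X u a → Adj F X a b → Reach F X u b

  Connected : VSet → Set
  Connected X = Nonempty X × (∀ u v → u ∈ X → v ∈ X → Reach ⊤ X u v)

  Joins : VSet → VSet → Set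
  Joins X Y = ∃ λ e → (src G e ∈ X × tgt G e ∈ Y) ⊎ (src G e ∈ Y × tgt G e ∈ X)

  IsCut : ESet → Set
  IsCut B = Σ VSet λ X → B ≡ δ X

  IsBond : ESet → Set
  IsBond B = IsCut B × Nonempty B ×
    (∀ B′ → IsCut B′ → Nonempty B′ → B′ ⊆ B → B ⊆ B′)

  IsComponent : VSet → Set
  IsComponent C = Connected C × δ C ≡ ⊥

  record Tripartition : Set where
    field
      X₁ X₂ X₃ : VSet
      comp     : IsComponent (X₁ ∪ (X₂ ∪ X₃))
      disj₁₂   : X₁ ∩ X₂ ≡ ⊥
      disj₁₃   : X₁ ∩ X₃ ≡ ⊥
      disj₂₃   : X₂ ∩ X₃ ≡ ⊥
      conn₁    : Connected X₁
      conn₂    : Connected X₂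
      conn₃    : Connected X₃
      join₁₂   : Joins X₁ X₂
      join₁₃   : Joins X₁ X₃
      join₂₃   : Joins X₂ X₃

  IsTribond : ESet → Set
  IsTribond T = Σ Tripartition λ P →
    T ≡ δ (Tripartition.X₁ P) ∪ (δ (Tripartition.X₂ P) ∪ δ (Tripartition.X₃ P))

  -- number of components of the spanning subgraph (V(G), F) is k
  NumComp : ESet → ℕ → Set
  NumComp F k = Σ (Fin (nV G) → Fin k) λ c →
    (∀ i → ∃ λ v → c v ≡ i) ×
    (∀ u v → (c u ≡ c v → Reach F ⊤ u v) × (Reach F ⊤ u v → c u ≡ c v))

  ModularPair : ESet → ESet → Set
  ModularPair B₁ B₂ = IsBond B₁ × IsBond B₂ ×
    (∃ λ k → NumComp ⊤ k × NumComp (∁ (B₁ ∪ B₂)) (2 + k))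

  IsDibond : ESet → Set
  IsDibond D = (∃ λ B₁ → ∃ λ B₂ → ModularPair B₁ B₂ × D ≡ B₁ ∪ B₂) × ¬ IsTribond D

  ExactlyTwo : Set → Set → Set → Set
  ExactlyTwo P Q R = (P × Q × ¬ R) ⊎ (P × ¬ Q × R) ⊎ (¬ P × Q × R)

  IsLinearClass : (ESet → Set) → Set
  IsLinearClass L = (∀ B → L B → IsBond B) ×
    (∀ (P : Tripartition) → ¬ ExactlyTwo (L (δ (Tripartition.X₁ P)))
                                          (L (δ (Tripartition.X₂ P)))
                                          (L (δ (Tripartition.X₃ P))))

  NonTrivial : (ESet → Set) → Set
  NonTrivial L = ¬ (∀ B → IsBond B → L B)

  -- The matroid J₀(G,L) on E(G) ∪ {e₀}: ground set Fin (suc nE),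
  -- element zero is e₀, element suc e is edge e.  A subset is written
  -- b ∷ S with b saying whether e₀ is in it.
  J₀Cocircuit : (ESet → Set) → Subset (suc (nE G)) → Set
  J₀Cocircuit L C =
      (∃ λ B → L B × C ≡ outside ∷ B)
    ⊎ (∃ λ B → IsBond B × ¬ L B × C ≡ inside ∷ B)
    ⊎ (∃ λ T → (IsTribond T ⊎ IsDibond T) ×
          (∀ B → L B → ¬ (B ⊆ T)) × C ≡ outside ∷ T)

  -- independent sets of the dual matroid J₀* : sets containing no cocircuit
  J₀DualIndep : (ESet → Set) → Subset (suc (nE G)) → Set
  J₀DualIndep L S = ∀ C → J₀Cocircuit L C → ¬ (C ⊆ S)

  -- J = J₀/e₀, so J* = J₀* \ e₀: independent sets of J* are the sets
  -- D ⊆ E(G) with D independent in J₀*.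
  JDualIndep : (ESet → Set) → ESet → Set
  JDualIndep L D = J₀DualIndep L (outside ∷ D)

  JDualBasis : (ESet → Set) → ESet → Set
  JDualBasis L D = JDualIndep L D × (∀ D′ → JDualIndep L D′ → D ⊆ D′ → D′ ⊆ D)

  -- bases of J(G,L) are the complements (in E(G)) of bases of J*
  JBasis : (ESet → Set) → ESet → Set
  JBasis L B = JDualBasis L (∁ B)

  -- forests: edge sets F such that every edge of F is a bridge of
  -- (V(G),F), i.e. its ends are not connected in F − e (excludes loops)
  IsForest : ESet → Set
  IsForest F = ∀ e → e ∈ F →
    ¬ Reach (F ∩ ∁ (tabulate λ e′ → does (e′ Data.Fin.≟ e))) ⊤ (src G e) (tgt G e)

  -- Ext(π_F) = edges whose ends lie in different components of (V(G),F)
  IsExt : ESet → ESet → Set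
  IsExt F S = ∀ e → (e ∈ S → ¬ Reach F ⊤ (src G e) (tgt G e))
                  × (¬ Reach F ⊤ (src G e) (tgt G e) → e ∈ S)

module Submission where

-- A set is independent in J* when it contains no bond of L and no tribond or dibond free of
-- bonds of L.  If F is a forest and X = Ext(π_F) is a bond not in L, every bond avoiding F is X
-- itself, which keeps ∁ F independent; and for e ∈ F, splitting components of F ∖ e between the
-- ends of e and of an edge of X gives a tribond or dibond avoiding F ∖ e, so ∁ F is maximal.
-- Conversely, for a basis B the same splittings show that B is a forest and that Ext(π_B) is a
-- bond (not in L, as it avoids B), unless Ext(π_B) is empty.  Then B spans G, and by induction on
-- |B′ ∩ B| every bond B′ lies in L: if B′ meets B in one edge it is a fundamental cut of B, whose
-- complement would otherwise be independent; if it meets B in e ≠ f, it is the middle cut of a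
-- tripartition whose two other cuts meet B in fewer edges, and linearity applies.  So L would be
-- trivial.

open import Defs
open import Data.Nat using (ℕ; zero; suc; _<_)
import Data.Nat.Properties as ℕ
open import Data.Fin using (Fin; zero; suc; _≟_; punchIn)
open import Data.Fin.Properties using (any?; suc-injective; pigeonhole; <⇒≢; punchIn-injective; punchInᵢ≢i)
open import Data.Fin.Subset
  using (Subset; _∈_; _∉_; _⊆_; ∁; _∪_; _∩_; ⊤; ⊥; Nonempty; Empty; ⁅_⁆; _-_; ∣_∣; outside; inside)
open import Data.Fin.Subset.Properties
open import Data.Vec using (_∷_; []; here; tabulate)
open import Data.Vec.Properties using (lookup∘tabulate; lookup⇒[]=; []=⇒lookup)
open import Data.Bool using (Bool; true; false; _xor_)
open import Data.Product using (Σ; ∃; ∃₂; _×_; _,_; proj₁; proj₂)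
open import Data.Sum as Sum using (_⊎_; inj₁; inj₂; [_,_]′)
open import Data.Empty using (⊥-elim) renaming (⊥ to ⊥′)
open import Function using (_∘′_)
open import Function.Bundles using (_⇔_; mk⇔)
open import Relation.Nullary using (¬_; Dec; yes; no; does)
open import Relation.Nullary.Decidable using (dec-true; map′; _×-dec_; _⊎-dec_; ¬?)
open import Relation.Unary using (Decidable)
open import Relation.Binary.PropositionalEquality using (_≡_; _≢_; refl; sym; trans; cong; subst)

private variable n : ℕ

∈-tabulate⁺ : {f : Fin n → Bool} {x : Fin n} → f x ≡ true → x ∈ tabulate f
∈-tabulate⁺ {f = f} {x} fx = lookup⇒[]= x (tabulate f) (trans (lookup∘tabulate f x) fx)

∈-tabulate⁻ : {f : Fin n → Bool} {x : Fin n} → x ∈ tabulate f → f x ≡ true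
∈-tabulate⁻ {f = f} {x} x∈ = trans (sym (lookup∘tabulate f x)) ([]=⇒lookup x∈)

toSubset : {P : Fin n → Set} → Decidable P → Subset n
toSubset P? = tabulate λ x → does (P? x)

module _ {P : Fin n → Set} (P? : Decidable P) {x : Fin n} where

  ∈-toSubset⁺ : P x → x ∈ toSubset P?
  ∈-toSubset⁺ p = ∈-tabulate⁺ (dec-true (P? x) p)

  ∈-toSubset⁻ : x ∈ toSubset P? → P x
  ∈-toSubset⁻ x∈ with P? x | ∈-tabulate⁻ {f = λ y → does (P? y)} x∈
  ... | yes p | _ = p

∈∪⁻ : {p q : Subset n} {x : Fin n} → x ∈ p ∪ q → x ∈ p ⊎ x ∈ q
∈∪⁻ {p = p} {q} = x∈p∪q⁻ p q

∈∩⁻ : {p q : Subset n} {x : Fin n} → x ∈ p ∩ q → x ∈ p × x ∈ q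
∈∩⁻ {p = p} {q} = x∈p∩q⁻ p q

∪-least : {p q r : Subset n} → p ⊆ r → q ⊆ r → p ∪ q ⊆ r
∪-least p⊆r q⊆r x∈ with ∈∪⁻ x∈
... | inj₁ x∈p = p⊆r x∈p
... | inj₂ x∈q = q⊆r x∈q

Disjoint : Subset n → Subset n → Set
Disjoint p q = ∀ {x} → x ∈ p → x ∉ q

disjoint-sym : {p q : Subset n} → Disjoint p q → Disjoint q p
disjoint-sym p#q x∈q x∈p = p#q x∈p x∈q

⊆∁⇒disjoint : {p q r : Subset n} → q ⊆ r → p ⊆ ∁ r → Disjoint p q
⊆∁⇒disjoint q⊆r p⊆∁r x∈p x∈q = x∈∁p⇒x∉p (p⊆∁r x∈p) (q⊆r x∈q)

∩≡⊥⇒disjoint : {p q : Subset n} → p ∩ q ≡ ⊥ → Disjoint p q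
∩≡⊥⇒disjoint p∩q≡⊥ x∈p x∈q = ∉⊥ (subst (_ ∈_) p∩q≡⊥ (x∈p∩q⁺ (x∈p , x∈q)))

disjoint⇒∩≡⊥ : {p q : Subset n} → Disjoint p q → p ∩ q ≡ ⊥
disjoint⇒∩≡⊥ p#q = ⊆-antisym (λ x∈ → ⊥-elim (p#q (proj₁ (∈∩⁻ x∈)) (proj₂ (∈∩⁻ x∈)))) (⊆-min _)

-- Not the library's p - y: this form is definitionally the F ∖ e used in IsForest.
_∖_ : Subset n → Fin n → Subset n
p ∖ y = p ∩ ∁ (toSubset (_≟ y))

module _ {p : Subset n} {x y : Fin n} where

  ∈∖⁺ : x ∈ p → x ≢ y → x ∈ p ∖ y
  ∈∖⁺ x∈p x≢y = x∈p∩q⁺ (x∈p , x∉p⇒x∈∁p λ x∈ → x≢y (∈-toSubset⁻ (_≟ y) x∈))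

  ∈∖⁻ : x ∈ p ∖ y → x ∈ p × x ≢ y
  ∈∖⁻ x∈ = proj₁ (∈∩⁻ x∈) , λ x≡y → x∈∁p⇒x∉p (proj₂ (∈∩⁻ x∈)) (∈-toSubset⁺ (_≟ y) x≡y)

∈⇒∈∖⊎≡ : {p : Subset n} {x y : Fin n} → x ∈ p → x ∈ p ∖ y ⊎ x ≡ y
∈⇒∈∖⊎≡ {x = x} {y} x∈p with x ≟ y
... | yes x≡y = inj₂ x≡y
... | no x≢y = inj₁ (∈∖⁺ x∈p x≢y)

∖-⊆ : (p : Subset n) (y : Fin n) → p ∖ y ⊆ p
∖-⊆ p y = p∩q⊆p p _

∁-⊆-∁∖ : (p : Subset n) (y : Fin n) → ∁ p ⊆ ∁ (p ∖ y)
∁-⊆-∁∖ p y = p⊆q⇒∁p⊇∁q (∖-⊆ p y)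

∈∁∖ : (p : Subset n) (y : Fin n) → y ∈ ∁ (p ∖ y)
∈∁∖ p y = x∉p⇒x∈∁p λ y∈ → proj₂ (∈∖⁻ y∈) refl

∁∖⊆ : {p q : Subset n} {y : Fin n} → ∁ p ⊆ q → y ∈ q → ∁ (p ∖ y) ⊆ q
∁∖⊆ {p = p} {y = y} ∁p⊆q y∈q {x} x∈ with x ∈? p | x ≟ y
... | no x∉p | _ = ∁p⊆q (x∉p⇒x∈∁p x∉p)
... | yes _ | yes refl = y∈q
... | yes x∈p | no x≢y = ⊥-elim (x∈∁p⇒x∉p x∈ (∈∖⁺ x∈p x≢y))

inside⊈outside : {p q : Subset n} → ¬ (inside ∷ p ⊆ outside ∷ q)
inside⊈outside sub with sub here
... | ()

¬¬-shift-Subset : (P : Subset n → Set) → (∀ S → ¬ ¬ P S) → ¬ ¬ (∀ S → P S)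
¬¬-shift-Subset {zero} P ¬¬P k = ¬¬P [] λ p → k λ { [] → p }
¬¬-shift-Subset {suc n} P ¬¬P k =
  ¬¬-shift-Subset (λ S → P (true ∷ S)) (λ S → ¬¬P (true ∷ S)) λ P-in →
  ¬¬-shift-Subset (λ S → P (false ∷ S)) (λ S → ¬¬P (false ∷ S)) λ P-out →
  k λ { (true ∷ S) → P-in S ; (false ∷ S) → P-out S }

module Walks (G : Graph) where

  open Graph G using () renaming (src to s; tgt to t)

  Vertex : Set
  Vertex = Fin (nV G)

  Edge : Set
  Edge = Fin (nE G)

  data Cross (P Q : Vertex → Set) (e : Edge) : Set where
    c₁ : P (s e) → Q (t e) → Cross P Q e
    c₂ : Q (s e) → P (t e) → Cross P Q e

  module _ {P Q : Vertex → Set} {e : Edge} where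

    cross-sym : Cross P Q e → Cross Q P e
    cross-sym (c₁ p q) = c₂ p q
    cross-sym (c₂ q p) = c₁ q p

    cross-map : {P′ Q′ : Vertex → Set} → (∀ {x} → P x → P′ x) → (∀ {x} → Q x → Q′ x) →
                Cross P Q e → Cross P′ Q′ e
    cross-map f g (c₁ p q) = c₁ (f p) (g q)
    cross-map f g (c₂ q p) = c₂ (g q) (f p)

  cross-split : {P Q R : Vertex → Set} {e : Edge} → Cross P (λ x → Q x ⊎ R x) e → Cross P Q e ⊎ Cross P R e
  cross-split (c₁ p (inj₁ q)) = inj₁ (c₁ p q)
  cross-split (c₁ p (inj₂ r)) = inj₂ (c₁ p r)
  cross-split (c₂ (inj₁ q) p) = inj₁ (c₂ q p)
  cross-split (c₂ (inj₂ r) p) = inj₂ (c₂ r p)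

  cross? : (X Y : VSet G) (e : Edge) → Dec (Cross (_∈ X) (_∈ Y) e)
  cross? X Y e with s e ∈? X | t e ∈? Y | s e ∈? Y | t e ∈? X
  ... | yes s∈X | yes t∈Y | _ | _ = yes (c₁ s∈X t∈Y)
  ... | _ | _ | yes s∈Y | yes t∈X = yes (c₂ s∈Y t∈X)
  ... | no s∉X | _ | no s∉Y | _ = no λ { (c₁ s∈X _) → s∉X s∈X ; (c₂ s∈Y _) → s∉Y s∈Y }
  ... | no s∉X | _ | yes _ | no t∉X = no λ { (c₁ s∈X _) → s∉X s∈X ; (c₂ _ t∈X) → t∉X t∈X }
  ... | yes _ | no t∉Y | no s∉Y | _ = no λ { (c₁ _ t∈Y) → t∉Y t∈Y ; (c₂ s∈Y _) → s∉Y s∈Y }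
  ... | yes _ | no t∉Y | yes _ | no t∉X = no λ { (c₁ _ t∈Y) → t∉Y t∈Y ; (c₂ _ t∈X) → t∉X t∈X }

  cross-both : {P : Vertex → Set} {e : Edge} → Cross P P e → P (s e) × P (t e)
  cross-both (c₁ p q) = p , q
  cross-both (c₂ q p) = q , p

  cross⇒joins : {X Y : VSet G} {e : Edge} → Cross (_∈ X) (_∈ Y) e → Joins G X Y
  cross⇒joins {e = e} (c₁ x y) = e , inj₁ (x , y)
  cross⇒joins {e = e} (c₂ y x) = e , inj₂ (y , x)

  Ends : Vertex → Vertex → Edge → Set
  Ends y z = Cross (_≡ y) (_≡ z)

  module _ {y z : Vertex} {e : Edge} where

    ends-cross : {P Q : Vertex → Set} → Ends y z e → P y → Q z → Cross P Q e
    ends-cross (c₁ refl refl) p q = c₁ p q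
    ends-cross (c₂ refl refl) p q = c₂ q p

    ends-sym : Ends y z e → Ends z y e
    ends-sym = cross-sym

  cross-ends : {P Q : Vertex → Set} {e : Edge} → Cross P Q e → ∃₂ λ y z → P y × Q z × Ends y z e
  cross-ends {e = e} (c₁ p q) = s e , t e , p , q , c₁ refl refl
  cross-ends {e = e} (c₂ q p) = t e , s e , p , q , c₂ refl refl

  module _ {W : VSet G} {e : Edge} where

    ∈δ⁺ : Cross (_∈ W) (_∉ W) e → e ∈ δ G W
    ∈δ⁺ c = ∈-tabulate⁺ (xor-true c (s e ∈? W) (t e ∈? W))
      where
      xor-true : Cross (_∈ W) (_∉ W) e → (d₁ : Dec (s e ∈ W)) (d₂ : Dec (t e ∈ W)) →
                 does d₁ xor does d₂ ≡ true
      xor-true _         (yes _)  (no _)   = refl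
      xor-true _         (no _)   (yes _)  = refl
      xor-true (c₁ _ t∉) (yes _)  (yes t∈) = ⊥-elim (t∉ t∈)
      xor-true (c₂ s∉ _) (yes s∈) (yes _)  = ⊥-elim (s∉ s∈)
      xor-true (c₁ s∈ _) (no s∉)  (no _)   = ⊥-elim (s∉ s∈)
      xor-true (c₂ _ t∈) (no _)   (no t∉)  = ⊥-elim (t∉ t∈)

    ∈δ⁻ : e ∈ δ G W → Cross (_∈ W) (_∉ W) e
    ∈δ⁻ e∈ with s e ∈? W | t e ∈? W | ∈-tabulate⁻ {f = λ e → does (s e ∈? W) xor does (t e ∈? W)} e∈
    ... | yes s∈ | no t∉ | _ = c₁ s∈ t∉
    ... | no s∉ | yes t∈ | _ = c₂ s∉ t∈

    ∉δ-inside : s e ∈ W → t e ∈ W → e ∉ δ G W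
    ∉δ-inside s∈ t∈ e∈ with ∈δ⁻ e∈
    ... | c₁ _ t∉ = t∉ t∈
    ... | c₂ s∉ _ = s∉ s∈

    ∉δ-outside : s e ∉ W → t e ∉ W → e ∉ δ G W
    ∉δ-outside s∉ t∉ e∈ with ∈δ⁻ e∈
    ... | c₁ s∈ _ = s∉ s∈
    ... | c₂ _ t∈ = t∉ t∈

  ends-∈δ-other : {W : VSet G} {y z : Vertex} {e : Edge} → Ends y z e → e ∈ δ G W → y ∉ W → z ∈ W
  ends-∈δ-other (c₁ refl refl) e∈ y∉ with ∈δ⁻ e∈
  ... | c₁ y∈ _ = ⊥-elim (y∉ y∈)
  ... | c₂ _ z∈ = z∈
  ends-∈δ-other (c₂ refl refl) e∈ y∉ with ∈δ⁻ e∈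
  ... | c₁ z∈ _ = z∈
  ... | c₂ _ y∈ = ⊥-elim (y∉ y∈)

  ∈δ∁⇒∈δ : {W : VSet G} {e : Edge} → e ∈ δ G (∁ W) → e ∈ δ G W
  ∈δ∁⇒∈δ e∈ = ∈δ⁺ (cross-sym (cross-map x∈∁p⇒x∉p x∉∁p⇒x∈p (∈δ⁻ e∈)))

  ends-∉δ : {W : VSet G} {y z : Vertex} {e : Edge} → Ends y z e → y ∉ W → z ∉ W → e ∉ δ G W
  ends-∉δ (c₁ refl refl) y∉ z∉ = ∉δ-outside y∉ z∉
  ends-∉δ (c₂ refl refl) y∉ z∉ = ∉δ-outside z∉ y∉

  joins⇒cross : {X Y : VSet G} → (j : Joins G X Y) → Cross (_∈ X) (_∈ Y) (proj₁ j)
  joins⇒cross (_ , inj₁ (x∈ , y∈)) = c₁ x∈ y∈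
  joins⇒cross (_ , inj₂ (y∈ , x∈)) = c₂ y∈ x∈

  joins-sym : {X Y : VSet G} → Joins G X Y → Joins G Y X
  joins-sym (e , j) = e , Sum.swap j

  joins⇒δ-nonempty : {X Y : VSet G} → Joins G X Y → Disjoint X Y → Nonempty (δ G X)
  joins⇒δ-nonempty j X#Y = proj₁ j , ∈δ⁺ (cross-map (λ x∈ → x∈) (λ y∈ x∈ → X#Y x∈ y∈) (joins⇒cross j))

  adj-ends : {F : ESet G} {X : VSet G} {a b : Vertex} (ab : Adj G F X a b) → Ends a b (proj₁ ab)
  adj-ends (_ , _ , _ , _ , inj₁ (refl , refl)) = c₁ refl refl
  adj-ends (_ , _ , _ , _ , inj₂ (refl , refl)) = c₂ refl refl

  ends-adj : {F : ESet G} {X : VSet G} {a b : Vertex} {e : Edge} → Ends a b e → e ∈ F → a ∈ X → b ∈ X → Adj G F X a b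
  ends-adj {e = e} (c₁ refl refl) e∈ a∈ b∈ = e , e∈ , a∈ , b∈ , inj₁ (refl , refl)
  ends-adj {e = e} (c₂ refl refl) e∈ a∈ b∈ = e , e∈ , a∈ , b∈ , inj₂ (refl , refl)

  module _ {F : ESet G} {X : VSet G} where

    adj-sym : {a b : Vertex} → Adj G F X a b → Adj G F X b a
    adj-sym ab@(_ , e∈ , a∈ , b∈ , _) = ends-adj (ends-sym (adj-ends ab)) e∈ b∈ a∈

    adj-cross : {a b : Vertex} {P Q : Vertex → Set} (ab : Adj G F X a b) → P a → Q b → Cross P Q (proj₁ ab)
    adj-cross ab = ends-cross (adj-ends ab)

    adj-inside : {a b : Vertex} (ab : Adj G F X a b) → s (proj₁ ab) ∈ X × t (proj₁ ab) ∈ X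
    adj-inside ab@(_ , _ , a∈ , b∈ , _) = cross-both (adj-cross ab a∈ b∈)

    reach-ends : {u v : Vertex} → Reach G F X u v → u ∈ X × v ∈ X
    reach-ends (here u∈) = u∈ , u∈
    reach-ends (step r (_ , _ , _ , b∈ , _)) = proj₁ (reach-ends r) , b∈

    reach-trans : {u v w : Vertex} → Reach G F X u v → Reach G F X v w → Reach G F X u w
    reach-trans r (here _) = r
    reach-trans r (step r′ ab) = step (reach-trans r r′) ab

    reach-adj : {a b : Vertex} → Adj G F X a b → Reach G F X a b
    reach-adj ab@(_ , _ , a∈ , _ , _) = step (here a∈) ab

    reach-sym : {u v : Vertex} → Reach G F X u v → Reach G F X v u
    reach-sym (here u∈) = here u∈
    reach-sym (step r ab) = reach-trans (reach-adj (adj-sym ab)) (reach-sym r)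

    reach-edge : {y z : Vertex} {e : Edge} → Ends y z e → e ∈ F → y ∈ X → z ∈ X → Reach G F X y z
    reach-edge yz e∈ y∈ z∈ = reach-adj (ends-adj yz e∈ y∈ z∈)

    reach-transfer : {F′ : ESet G} {u v : Vertex} → (∀ {e} → e ∈ F → s e ∈ X → t e ∈ X → e ∈ F′) →
                     Reach G F X u v → Reach G F′ X u v
    reach-transfer F⊆F′ (here u∈) = here u∈
    reach-transfer F⊆F′ (step r ab@(_ , e∈ , a∈ , b∈ , _)) =
      step (reach-transfer F⊆F′ r) (ends-adj (adj-ends ab) (F⊆F′ e∈ (proj₁ (adj-inside ab)) (proj₂ (adj-inside ab))) a∈ b∈)

  reach-between-ends : {F : ESet G} {X : VSet G} {y z : Vertex} {e : Edge} → Ends y z e →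
                       Reach G F X y z → Reach G F X (s e) (t e)
  reach-between-ends (c₁ refl refl) r = r
  reach-between-ends (c₂ refl refl) r = reach-sym r

  reach-mono : {F F′ : ESet G} {X X′ : VSet G} {u v : Vertex} → F ⊆ F′ → X ⊆ X′ →
               Reach G F X u v → Reach G F′ X′ u v
  reach-mono F⊆ X⊆ (here u∈) = here (X⊆ u∈)
  reach-mono F⊆ X⊆ (step r (e , e∈ , a∈ , b∈ , o)) = step (reach-mono F⊆ X⊆ r) (e , F⊆ e∈ , X⊆ a∈ , X⊆ b∈ , o)

  reach-link : (e : Edge) → Reach G ⊤ ⊤ (s e) (t e)
  reach-link e = reach-edge (c₁ refl refl) ∈⊤ ∈⊤ ∈⊤

  ReachVia : ESet G → VSet G → Edge → Vertex → Vertex → Set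
  ReachVia F₀ X g x y =
    Reach G F₀ X x y ⊎ (Reach G F₀ X x (s g) × Reach G F₀ X (t g) y) ⊎ (Reach G F₀ X x (t g) × Reach G F₀ X (s g) y)

  module _ {F F₀ : ESet G} {X : VSet G} {g : Edge} where

    reach⇒via : {x y : Vertex} → (∀ {e} → e ∈ F → e ∈ F₀ ⊎ e ≡ g) → Reach G F X x y → ReachVia F₀ X g x y
    reach⇒via split (here x∈) = inj₁ (here x∈)
    reach⇒via {x} split (step {a} {b} r ab@(e , e∈ , a∈ , b∈ , _)) = extend (reach⇒via split r) (split e∈) (adj-ends ab)
      where
      extend : ReachVia F₀ X g x a → e ∈ F₀ ⊎ e ≡ g → Ends a b e → ReachVia F₀ X g x b
      extend (inj₁ r₀) (inj₁ e∈₀) ab = inj₁ (reach-trans r₀ (reach-edge ab e∈₀ a∈ b∈))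
      extend (inj₂ (inj₁ (p , q))) (inj₁ e∈₀) ab = inj₂ (inj₁ (p , reach-trans q (reach-edge ab e∈₀ a∈ b∈)))
      extend (inj₂ (inj₂ (p , q))) (inj₁ e∈₀) ab = inj₂ (inj₂ (p , reach-trans q (reach-edge ab e∈₀ a∈ b∈)))
      extend (inj₁ r₀) (inj₂ refl) (c₁ refl refl) = inj₂ (inj₁ (r₀ , here b∈))
      extend (inj₂ (inj₁ (p , _))) (inj₂ refl) (c₁ refl refl) = inj₂ (inj₁ (p , here b∈))
      extend (inj₂ (inj₂ (p , _))) (inj₂ refl) (c₁ refl refl) = inj₁ p
      extend (inj₁ r₀) (inj₂ refl) (c₂ refl refl) = inj₂ (inj₂ (r₀ , here b∈))
      extend (inj₂ (inj₁ (p , _))) (inj₂ refl) (c₂ refl refl) = inj₁ p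
      extend (inj₂ (inj₂ (p , _))) (inj₂ refl) (c₂ refl refl) = inj₂ (inj₂ (p , here b∈))

    via⇒reach : {x y : Vertex} → F₀ ⊆ F → g ∈ F → ReachVia F₀ X g x y → Reach G F X x y
    via⇒reach F₀⊆ g∈ (inj₁ r) = reach-mono F₀⊆ (λ z → z) r
    via⇒reach F₀⊆ g∈ (inj₂ (inj₁ (p , q))) =
      reach-trans (reach-mono F₀⊆ (λ z → z) p)
        (reach-trans (reach-edge (c₁ refl refl) g∈ (proj₂ (reach-ends p)) (proj₁ (reach-ends q)))
                     (reach-mono F₀⊆ (λ z → z) q))
    via⇒reach F₀⊆ g∈ (inj₂ (inj₂ (p , q))) =
      reach-trans (reach-mono F₀⊆ (λ z → z) p)
        (reach-trans (reach-edge (c₂ refl refl) g∈ (proj₂ (reach-ends p)) (proj₁ (reach-ends q)))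
                     (reach-mono F₀⊆ (λ z → z) q))

  reach-empty : {F : ESet G} {X : VSet G} {u v : Vertex} → Empty F → Reach G F X u v → u ≡ v
  reach-empty F≡∅ (here _) = refl
  reach-empty F≡∅ (step _ (e , e∈ , _)) = ⊥-elim (F≡∅ (e , e∈))

  private
    reach?-< : (n : ℕ) (F : ESet G) → ∣ F ∣ < n → ∀ X u v → Dec (Reach G F X u v)
    reach?-< (suc n) F |F|<n X u v with nonempty? F
    ... | no F≡∅ with u ≟ v | u ∈? X
    ...   | yes refl | yes u∈ = yes (here u∈)
    ...   | yes refl | no u∉ = no λ r → u∉ (proj₁ (reach-ends r))
    ...   | no u≢v | _ = no λ r → u≢v (reach-empty F≡∅ r)
    reach?-< (suc n) F |F|<n X u v | yes (g , g∈) =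
      map′ (via⇒reach (p─q⊆p F ⁅ g ⁆) g∈) (reach⇒via split)
        (r? u v ⊎-dec ((r? u (s g) ×-dec r? (t g) v) ⊎-dec (r? u (t g) ×-dec r? (s g) v)))
      where
      r? : ∀ x y → Dec (Reach G (F - g) X x y)
      r? = reach?-< n (F - g) (ℕ.<-≤-trans (x∈p⇒∣p-x∣<∣p∣ g∈) (ℕ.≤-pred |F|<n)) X
      split : ∀ {e} → e ∈ F → e ∈ F - g ⊎ e ≡ g
      split {e} e∈ with e ≟ g
      ... | yes e≡g = inj₂ e≡g
      ... | no e≢g = inj₁ (x∈p∧x≢y⇒x∈p-y e∈ e≢g)

  reach? : (F : ESet G) (X : VSet G) (u v : Vertex) → Dec (Reach G F X u v)
  reach? F = reach?-< (suc ∣ F ∣) F (ℕ.n<1+n _)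

module Components (G : Graph) where

  open Graph G using () renaming (src to s; tgt to t)
  open Walks G

  exit : {F : ESet G} {X : VSet G} {u v : Vertex} (W : VSet G) → Reach G F X u v → u ∈ W → v ∉ W →
         ∃ λ e → e ∈ F × e ∈ δ G W × s e ∈ X × t e ∈ X
  exit W (here _) u∈ v∉ = ⊥-elim (v∉ u∈)
  exit W (step {a} r ab@(e , e∈ , _)) u∈ b∉ with a ∈? W
  ... | no a∉ = exit W r u∈ a∉
  ... | yes a∈ = e , e∈ , ∈δ⁺ (adj-cross ab a∈ b∉) , adj-inside ab

  reach-stays : {F : ESet G} {X : VSet G} {u v : Vertex} (W : VSet G) → (∀ {e} → e ∈ F → e ∉ δ G W) →
                Reach G F X u v → u ∈ W → v ∈ W
  reach-stays {v = v} W F∩δW≡∅ r u∈ with v ∈? W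
  ... | yes v∈ = v∈
  ... | no v∉ = let (e , e∈ , e∈δ , _) = exit W r u∈ v∉ in ⊥-elim (F∩δW≡∅ e∈ e∈δ)

  connected-ends-∉δ : {F : ESet G} {W : VSet G} {g : Edge} → δ G W ⊆ ∁ F → Reach G F ⊤ (s g) (t g) → g ∉ δ G W
  connected-ends-∉δ {F} {W} {g} δW⊆∁F r g∈ = separated (∈δ⁻ g∈)
    where
    F-avoids-δW : ∀ {e} → e ∈ F → e ∉ δ G W
    F-avoids-δW e∈F e∈δ = x∈∁p⇒x∉p (δW⊆∁F e∈δ) e∈F
    separated : ¬ Cross (_∈ W) (_∉ W) g
    separated (c₁ s∈ t∉) = t∉ (reach-stays W F-avoids-δW r s∈)
    separated (c₂ s∉ t∈) = s∉ (reach-stays W F-avoids-δW (reach-sym r) t∈)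

  reachable : ESet G → VSet G → Vertex → VSet G
  reachable F X u = toSubset (reach? F X u)

  module _ {F : ESet G} {X : VSet G} {u : Vertex} where

    ∈reachable⁺ : {v : Vertex} → Reach G F X u v → v ∈ reachable F X u
    ∈reachable⁺ = ∈-toSubset⁺ (reach? F X u)

    ∈reachable⁻ : {v : Vertex} → v ∈ reachable F X u → Reach G F X u v
    ∈reachable⁻ = ∈-toSubset⁻ (reach? F X u)

    reachable-⊆ : reachable F X u ⊆ X
    reachable-⊆ v∈ = proj₂ (reach-ends (∈reachable⁻ v∈))

    reach-within-reachable : {a b : Vertex} → a ∈ reachable F X u → Reach G F X a b → Reach G F (reachable F X u) a b
    reach-within-reachable a∈ (here _) = here a∈
    reach-within-reachable a∈ (step r (e , e∈ , ab)) =
      step (reach-within-reachable a∈ r)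
        (e , e∈ , ∈reachable⁺ (reach-trans (∈reachable⁻ a∈) r) ,
         ∈reachable⁺ (step (reach-trans (∈reachable⁻ a∈) r) (e , e∈ , ab)) , proj₂ (proj₂ ab))

    reachable-closed : {e : Edge} → e ∈ F → s e ∈ X → t e ∈ X → e ∉ δ G (reachable F X u)
    reachable-closed e∈ s∈X t∈X e∈δ with ∈δ⁻ e∈δ
    ... | c₁ s∈ t∉ = t∉ (∈reachable⁺ (reach-trans (∈reachable⁻ s∈) (reach-edge (c₁ refl refl) e∈ s∈X t∈X)))
    ... | c₂ s∉ t∈ = s∉ (∈reachable⁺ (reach-trans (∈reachable⁻ t∈) (reach-edge (c₂ refl refl) e∈ t∈X s∈X)))

  δ-reachable⊆δ : {X : VSet G} {r : Vertex} → δ G (reachable ⊤ X r) ⊆ δ G X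
  δ-reachable⊆δ {X} {r} g∈ with cross-ends (∈δ⁻ g∈)
  ... | y , z , y∈ , z∉ , yz with z ∈? X
  ...   | yes z∈X = ⊥-elim (z∉ (∈reachable⁺ (reach-trans (∈reachable⁻ y∈) (reach-edge yz ∈⊤ (reachable-⊆ y∈) z∈X))))
  ...   | no z∉X = ∈δ⁺ (ends-cross yz (reachable-⊆ y∈) z∉X)

  Conn : VSet G → Set
  Conn X = ∀ a b → a ∈ X → b ∈ X → Reach G ⊤ X a b

  reachable-conn : {F : ESet G} {X : VSet G} {u : Vertex} → Conn (reachable F X u)
  reachable-conn a b a∈ b∈ =
    reach-mono ⊆⊤ (λ z → z) (reach-within-reachable a∈ (reach-trans (reach-sym (∈reachable⁻ a∈)) (∈reachable⁻ b∈)))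

  reach-across : {X Y : VSet G} {j : Edge} → Conn X → Conn Y → Cross (_∈ X) (_∈ Y) j →
                 ∀ {a b} → a ∈ X → b ∈ Y → Reach G ⊤ (X ∪ Y) a b
  reach-across {X} {Y} cX cY jXY {a} {b} a∈ b∈ =
    let (x , y , x∈ , y∈ , xy) = cross-ends jXY in
    reach-trans (reach-mono (λ z → z) (p⊆p∪q Y) (cX a x a∈ x∈))
      (reach-trans (reach-edge xy ∈⊤ (p⊆p∪q Y x∈) (q⊆p∪q X Y y∈)) (reach-mono (λ z → z) (q⊆p∪q X Y) (cY y b y∈ b∈)))

  conn-∪ : {X Y : VSet G} {j : Edge} → Conn X → Conn Y → Cross (_∈ X) (_∈ Y) j → Conn (X ∪ Y)
  conn-∪ {X} {Y} cX cY jXY a b a∈ b∈ with ∈∪⁻ a∈ | ∈∪⁻ b∈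
  ... | inj₁ a∈X | inj₁ b∈X = reach-mono (λ z → z) (p⊆p∪q Y) (cX a b a∈X b∈X)
  ... | inj₂ a∈Y | inj₂ b∈Y = reach-mono (λ z → z) (q⊆p∪q X Y) (cY a b a∈Y b∈Y)
  ... | inj₁ a∈X | inj₂ b∈Y = reach-across cX cY jXY a∈X b∈Y
  ... | inj₂ a∈Y | inj₁ b∈X = reach-sym (reach-across cX cY jXY b∈X a∈Y)

  reach-avoiding : {F : ESet G} {X : VSet G} {D : ESet G} → (∀ {e} → s e ∈ X → t e ∈ X → e ∉ D) →
                   ∀ {x y} → Reach G F X x y → Reach G (∁ D) ⊤ x y
  reach-avoiding X-avoids-D r =
    reach-mono (λ e∈ → e∈) ⊆⊤ (reach-transfer (λ _ s∈ t∈ → x∉p⇒x∈∁p (X-avoids-D s∈ t∈)) r)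

  inside-∉δ : {X W : VSet G} → X ⊆ W ⊎ Disjoint X W → ∀ {e} → s e ∈ X → t e ∈ X → e ∉ δ G W
  inside-∉δ (inj₁ X⊆W) s∈ t∈ = ∉δ-inside (X⊆W s∈) (X⊆W t∈)
  inside-∉δ (inj₂ X#W) s∈ t∈ = ∉δ-outside (X#W s∈) (X#W t∈)

  inside-∉δ∪δ : {X A B : VSet G} → X ⊆ A ⊎ Disjoint X A → X ⊆ B ⊎ Disjoint X B →
                ∀ {e} → s e ∈ X → t e ∈ X → e ∉ δ G A ∪ δ G B
  inside-∉δ∪δ XA XB s∈ t∈ e∈ with ∈∪⁻ e∈
  ... | inj₁ e∈δA = inside-∉δ XA s∈ t∈ e∈δA
  ... | inj₂ e∈δB = inside-∉δ XB s∈ t∈ e∈δB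

  conn-inside : {X W : VSet G} → Conn X → (∀ {e} → s e ∈ X → t e ∈ X → e ∉ δ G W) →
                ∀ {x y} → x ∈ X → y ∈ X → x ∈ W → y ∈ W
  conn-inside {W = W} cX X-avoids-δW {x} {y} x∈ y∈ =
    reach-stays W (x∈∁p⇒x∉p {p = δ G W}) (reach-avoiding X-avoids-δW (cX x y x∈ y∈))

  -- A cut δ Y′ ⊆ δ Y splits neither Y nor Z, which are connected by edges outside δ Y; as it
  -- contains a Y–Z edge, Y′ separates Y from Z, so it contains all of δ Y.
  isBond-δ : {j : Edge} (Y Z : VSet G) → Disjoint Y Z → Conn Y → Conn Z → Cross (_∈ Y) (_∈ Z) j →
             (∀ {e} → Cross (_∈ Y) (_∉ Y) e → Cross (_∈ Y) (_∈ Z) e) → IsBond G (δ G Y)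
  isBond-δ {j} Y Z Y#Z cY cZ jYZ leaveY =
    (Y , refl) , (j , ∈δ⁺ (cross-map (λ y∈ → y∈) (λ z∈ y∈ → Y#Z y∈ z∈) jYZ)) , minimal
    where
    minimal : ∀ B′ → IsCut G B′ → Nonempty B′ → B′ ⊆ δ G Y → δ G Y ⊆ B′
    minimal _ (Y′ , refl) (e′ , e′∈) δY′⊆δY {g} g∈ = ∈δ⁺ (orient (leaveY (∈δ⁻ (δY′⊆δY e′∈))) (∈δ⁻ e′∈) (leaveY (∈δ⁻ g∈)))
      where
      onY : ∀ {a b} → a ∈ Y → b ∈ Y → a ∈ Y′ → b ∈ Y′
      onY = conn-inside cY λ s∈ t∈ e∈ → ∉δ-inside s∈ t∈ (δY′⊆δY e∈)
      onZ : ∀ {a b} → a ∈ Z → b ∈ Z → a ∈ Y′ → b ∈ Y′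
      onZ = conn-inside cZ λ s∈ t∈ e∈ → ∉δ-outside (λ s∈Y → Y#Z s∈Y s∈) (λ t∈Y → Y#Z t∈Y t∈) (δY′⊆δY e∈)
      orient : Cross (_∈ Y) (_∈ Z) e′ → Cross (_∈ Y′) (_∉ Y′) e′ → Cross (_∈ Y) (_∈ Z) g → Cross (_∈ Y′) (_∉ Y′) g
      orient (c₁ y z) (c₁ y′ z′) = cross-map (λ a → onY y a y′) (λ b b′ → z′ (onZ b z b′))
      orient (c₁ y z) (c₂ y′ z′) = cross-sym ∘′ cross-map (λ a a′ → y′ (onY a y a′)) (λ b → onZ z b z′)
      orient (c₂ z y) (c₁ z′ y′) = cross-sym ∘′ cross-map (λ a a′ → y′ (onY a y a′)) (λ b → onZ z b z′)
      orient (c₂ z y) (c₂ z′ y′) = cross-map (λ a → onY y a y′) (λ b b′ → z′ (onZ b z b′))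

  Isolated : VSet G → Set
  Isolated C = ∀ {e} → e ∉ δ G C

  isolated⇒δ≡⊥ : {C : VSet G} → Isolated C → δ G C ≡ ⊥
  isolated⇒δ≡⊥ isoC = ⊆-antisym (λ e∈ → ⊥-elim (isoC e∈)) (⊆-min _)

  δ≡⊥⇒isolated : {C : VSet G} → δ G C ≡ ⊥ → Isolated C
  δ≡⊥⇒isolated δC≡⊥ e∈ = ∉⊥ (subst (_ ∈_) δC≡⊥ e∈)

  isolated-ends : {C : VSet G} {e : Edge} → Isolated C → s e ∈ C ⊎ t e ∈ C → s e ∈ C × t e ∈ C
  isolated-ends {C} {e} isoC end∈ with s e ∈? C | t e ∈? C | end∈
  ... | yes s∈ | yes t∈ | _ = s∈ , t∈
  ... | yes s∈ | no t∉ | _ = ⊥-elim (isoC (∈δ⁺ (c₁ s∈ t∉)))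
  ... | no s∉ | yes t∈ | _ = ⊥-elim (isoC (∈δ⁺ (c₂ s∉ t∈)))
  ... | no s∉ | no _ | inj₁ s∈ = ⊥-elim (s∉ s∈)
  ... | no _ | no t∉ | inj₂ t∈ = ⊥-elim (t∉ t∈)

  leave-isolated : {C X : VSet G} {e : Edge} → Isolated C → X ⊆ C →
                   Cross (_∈ X) (_∉ X) e → Cross (_∈ X) (λ x → x ∉ X × x ∈ C) e
  leave-isolated isoC X⊆C (c₁ s∈ t∉) = c₁ s∈ (t∉ , proj₂ (isolated-ends isoC (inj₁ (X⊆C s∈))))
  leave-isolated isoC X⊆C (c₂ s∉ t∈) = c₂ (s∉ , proj₁ (isolated-ends isoC (inj₂ (X⊆C t∈)))) t∈

  reach-off-isolated : {F : ESet G} {X : VSet G} {u v : Vertex} (W : VSet G) → Isolated W → u ∉ W →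
                Reach G F X u v → Reach G F (X ∩ ∁ W) u v
  reach-off-isolated W isoW u∉ (here u∈) = here (x∈p∩q⁺ (u∈ , x∉p⇒x∈∁p u∉))
  reach-off-isolated {F} {X} {u} W isoW u∉ (step {a} {b} r ab@(e , e∈ , _ , b∈ , o)) =
    step r′ (e , e∈ , proj₂ (reach-ends r′) , x∈p∩q⁺ (b∈ , x∉p⇒x∈∁p b∉) , o)
    where
    r′ : Reach G F (X ∩ ∁ W) u a
    r′ = reach-off-isolated W isoW u∉ r
    b∉ : b ∉ W
    b∉ b∈W = isoW (∈δ⁺ (cross-sym (adj-cross ab (x∈∁p⇒x∉p (proj₂ (∈∩⁻ (proj₂ (reach-ends r′))))) b∈W)))

  component : Vertex → VSet G
  component = reachable ⊤ ⊤

  component-isolated : {u : Vertex} → Isolated (component u)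
  component-isolated = reachable-closed ∈⊤ ∈⊤ ∈⊤

  δ-three-disjoint : {X Y Z : VSet G} {e : Edge} → Disjoint X Y → Disjoint X Z → Disjoint Y Z →
                     e ∈ δ G X → e ∈ δ G Y → e ∈ δ G Z → ⊥′
  δ-three-disjoint X#Y X#Z Y#Z eX eY eZ with ∈δ⁻ eX | ∈δ⁻ eY | ∈δ⁻ eZ
  ... | c₁ x _ | c₁ y _ | _      = X#Y x y
  ... | c₁ x _ | c₂ _ _ | c₁ z _ = X#Z x z
  ... | c₁ _ _ | c₂ _ y | c₂ _ z = Y#Z y z
  ... | c₂ _ x | c₂ _ y | _      = X#Y x y
  ... | c₂ _ x | c₁ _ _ | c₂ _ z = X#Z x z
  ... | c₂ _ _ | c₁ y _ | c₁ z _ = Y#Z y z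

module Splitting (G : Graph) where

  open Graph G using () renaming (src to s; tgt to t)
  open Walks G
  open Components G

  record Split (S : VSet G) (F : ESet G) (u v : Vertex) : Set where
    field
      X₁ X₂     : VSet G
      cover     : ∀ {x} → x ∈ S → x ∈ X₁ ⊎ x ∈ X₂
      X₁⊆S      : X₁ ⊆ S
      X₂⊆S      : X₂ ⊆ S
      X₁#X₂     : Disjoint X₁ X₂
      u∈X₁      : u ∈ X₁
      v∈X₂      : v ∈ X₂
      conn₁     : Conn X₁
      conn₂     : Conn X₂
      no-F-edge : ∀ {e} → e ∈ F → ¬ Cross (_∈ X₁) (_∈ X₂) e

    to₂ : ∀ {x} → x ∈ S → x ∉ X₁ → x ∈ X₂
    to₂ x∈ x∉ with cover x∈
    ... | inj₁ x∈₁ = ⊥-elim (x∉ x∈₁)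
    ... | inj₂ x∈₂ = x∈₂

    to₁ : ∀ {x} → x ∈ S → x ∉ X₂ → x ∈ X₁
    to₁ x∈ x∉ with cover x∈
    ... | inj₁ x∈₁ = x∈₁
    ... | inj₂ x∈₂ = ⊥-elim (x∉ x∈₂)

    joining-edge : Conn S → ∃ λ e → Cross (_∈ X₁) (_∈ X₂) e
    joining-edge cS with exit X₁ (cS u v (X₁⊆S u∈X₁) (X₂⊆S v∈X₂)) u∈X₁ (λ v∈X₁ → X₁#X₂ v∈X₁ v∈X₂)
    ... | e , _ , e∈δ , s∈ , t∈ with ∈δ⁻ e∈δ
    ...   | c₁ s∈₁ t∉₁ = e , c₁ s∈₁ (to₂ t∈ t∉₁)
    ...   | c₂ s∉₁ t∈₁ = e , c₂ (to₂ s∈ s∉₁) t∈₁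

    δX₁-edge : Conn S → ∃ λ e → e ∈ δ G X₁ × s e ∈ S
    δX₁-edge cS = let (e , j) = joining-edge cS in
      e , ∈δ⁺ (cross-map (λ x∈ → x∈) (λ x∈₂ x∈₁ → X₁#X₂ x∈₁ x∈₂) j) , proj₁ (cross-both (cross-map X₁⊆S X₂⊆S j))

    module _ (isoS : Isolated S) where

      leave₁ : ∀ {e} → Cross (_∈ X₁) (_∉ X₁) e → Cross (_∈ X₁) (_∈ X₂) e
      leave₁ c = cross-map (λ x∈ → x∈) (λ (x∉ , x∈) → to₂ x∈ x∉) (leave-isolated isoS X₁⊆S c)

      δX₁-isBond : Conn S → IsBond G (δ G X₁)
      δX₁-isBond cS = isBond-δ X₁ X₂ X₁#X₂ conn₁ conn₂ (proj₂ (joining-edge cS)) leave₁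

    δX₁⊆∁F : δ G S ⊆ ∁ F → δ G X₁ ⊆ ∁ F
    δX₁⊆∁F δS⊆∁F {e} e∈ = x∉p⇒x∈∁p λ e∈F → leaves-via-F e∈F (∈δ⁻ e∈)
      where
      leaves-via-F : e ∈ F → ¬ Cross (_∈ X₁) (_∉ X₁) e
      leaves-via-F e∈F (c₁ s∈ t∉) with t e ∈? S
      ... | yes t∈S = no-F-edge e∈F (c₁ s∈ (to₂ t∈S t∉))
      ... | no t∉S = x∈∁p⇒x∉p (δS⊆∁F (∈δ⁺ (c₁ (X₁⊆S s∈) t∉S))) e∈F
      leaves-via-F e∈F (c₂ s∉ t∈) with s e ∈? S
      ... | yes s∈S = no-F-edge e∈F (c₂ (to₂ s∈S s∉) t∈)
      ... | no s∉S = x∈∁p⇒x∉p (δS⊆∁F (∈δ⁺ (c₂ s∉S (X₁⊆S t∈)))) e∈F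

  split-swap : ∀ {S F u v} → Split S F u v → Split S F v u
  split-swap sp = record
    { X₁ = X₂ ; X₂ = X₁ ; cover = Sum.swap ∘′ cover ; X₁⊆S = X₂⊆S ; X₂⊆S = X₁⊆S ; X₁#X₂ = disjoint-sym X₁#X₂
    ; u∈X₁ = v∈X₂ ; v∈X₂ = u∈X₁ ; conn₁ = conn₂ ; conn₂ = conn₁ ; no-F-edge = λ e∈ → no-F-edge e∈ ∘′ cross-sym }
    where open Split sp

  split-mono : ∀ {S F F′ u v} → F ⊆ F′ → Split S F′ u v → Split S F u v
  split-mono F⊆F′ sp = record
    { X₁ = X₁ ; X₂ = X₂ ; cover = cover ; X₁⊆S = X₁⊆S ; X₂⊆S = X₂⊆S ; X₁#X₂ = X₁#X₂
    ; u∈X₁ = u∈X₁ ; v∈X₂ = v∈X₂ ; conn₁ = conn₁ ; conn₂ = conn₂ ; no-F-edge = no-F-edge ∘′ F⊆F′ }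
    where open Split sp

  private
    reachable-split : ∀ {S F u v} → u ∈ S → v ∈ S → ¬ Reach G F S u v →
                      (∀ {x} → x ∈ S → Reach G F S u x ⊎ Reach G F S v x) → Split S F u v
    reachable-split {S} {F} {u} {v} u∈ v∈ u↛v reached = record
      { X₁ = reachable F S u ; X₂ = reachable F S v
      ; cover = λ x∈ → Sum.map ∈reachable⁺ ∈reachable⁺ (reached x∈)
      ; X₁⊆S = reachable-⊆ ; X₂⊆S = reachable-⊆
      ; X₁#X₂ = disj
      ; u∈X₁ = ∈reachable⁺ (here u∈) ; v∈X₂ = ∈reachable⁺ (here v∈)
      ; conn₁ = reachable-conn ; conn₂ = reachable-conn
      ; no-F-edge = λ e∈F c → let (s∈ , t∈) = cross-both (cross-map reachable-⊆ reachable-⊆ c) in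
          reachable-closed e∈F s∈ t∈ (∈δ⁺ (cross-map (λ x∈ → x∈) (λ x∈₂ x∈₁ → disj x∈₁ x∈₂) c)) }
      where
      disj : Disjoint (reachable F S u) (reachable F S v)
      disj x∈₁ x∈₂ = u↛v (reach-trans (∈reachable⁻ x∈₁) (reach-sym (∈reachable⁻ x∈₂)))

    -- Induction on the number of edges outside F: a vertex w reached from neither u nor v
    -- lets us add to F an edge leaving the F-class of w.
    split-< : (n : ℕ) (S : VSet G) (F : ESet G) {u v : Vertex} → ∣ ∁ F ∣ < n → Conn S → u ∈ S → v ∈ S →
              ¬ Reach G F S u v → Split S F u v
    split-< (suc n) S F {u} {v} |∁F|<n cS u∈ v∈ u↛v
      with any? (λ w → w ∈? S ×-dec ¬? (reach? F S u w) ×-dec ¬? (reach? F S v w))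
    ... | no none-unreached = reachable-split u∈ v∈ u↛v reached
      where
      reached : ∀ {x} → x ∈ S → Reach G F S u x ⊎ Reach G F S v x
      reached {x} x∈ with reach? F S u x | reach? F S v x
      ... | yes r | _ = inj₁ r
      ... | no _ | yes r = inj₂ r
      ... | no u↛x | no v↛x = ⊥-elim (none-unreached (x , x∈ , u↛x , v↛x))
    ... | yes (w , w∈ , u↛w , v↛w)
      with exit (reachable F S w) (cS w u w∈ u∈) (∈reachable⁺ (here w∈)) (u↛w ∘′ reach-sym ∘′ ∈reachable⁻)
    ...   | e , _ , e∈δ , s∈ , t∈ = split-mono (p⊆p∪q _) (split-< n S F′ |∁F′|<n cS u∈ v∈ u↛v′)
      where
      F′ : ESet G
      F′ = F ∪ ⁅ e ⁆
      e∉F : e ∉ F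
      e∉F e∈F = reachable-closed e∈F s∈ t∈ e∈δ
      |∁F′|<n : ∣ ∁ F′ ∣ < n
      |∁F′|<n = ℕ.<-≤-trans
        (p⊂q⇒∣p∣<∣q∣ (p⊆q⇒∁p⊇∁q (p⊆p∪q _) , e , x∉p⇒x∈∁p e∉F , x∈p⇒x∉∁p (q⊆p∪q F _ (x∈⁅x⁆ e))))
        (ℕ.≤-pred |∁F|<n)
      u↛v′ : ¬ Reach G F′ S u v
      u↛v′ r with reach⇒via {F₀ = F} {g = e} (Sum.map₂ (x∈⁅y⁆⇒x≡y e) ∘′ ∈∪⁻) r | ∈δ⁻ e∈δ
      ... | inj₁ r₀ | _ = u↛v r₀
      ... | inj₂ (inj₁ (p , _)) | c₁ s∈K _ = u↛w (reach-trans p (reach-sym (∈reachable⁻ s∈K)))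
      ... | inj₂ (inj₁ (_ , q)) | c₂ _ t∈K = v↛w (reach-trans (reach-sym q) (reach-sym (∈reachable⁻ t∈K)))
      ... | inj₂ (inj₂ (_ , q)) | c₁ s∈K _ = v↛w (reach-trans (reach-sym q) (reach-sym (∈reachable⁻ s∈K)))
      ... | inj₂ (inj₂ (p , _)) | c₂ _ t∈K = u↛w (reach-trans p (reach-sym (∈reachable⁻ t∈K)))

  split : ∀ {S F u v} → Conn S → u ∈ S → v ∈ S → ¬ Reach G F S u v → Split S F u v
  split {S} {F} = split-< (suc ∣ ∁ F ∣) S F (ℕ.n<1+n _)

Labelling : (n : ℕ) → (Fin n → Fin n → Set) → ℕ → Set
Labelling n R k = Σ (Fin n → Fin k) λ c →
  (∀ i → ∃ λ v → c v ≡ i) × (∀ u v → (c u ≡ c v → R u v) × (R u v → c u ≡ c v))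

labelling : ∀ n (R : Fin n → Fin n → Set) → (∀ x y → Dec (R x y)) →
            (∀ x → R x x) → (∀ {x y} → R x y → R y x) → (∀ {x y z} → R x y → R y z → R x z) →
            ∃ λ k → Labelling n R k
labelling zero R R? refl′ sym′ trans′ = 0 , (λ ()) , (λ ()) , λ ()
labelling (suc n) R R? refl′ sym′ trans′
  with labelling n (λ x y → R (suc x) (suc y)) (λ x y → R? (suc x) (suc y)) (λ x → refl′ (suc x)) sym′ trans′
... | k , c , c-onto , c-classes with any? (λ w → R? zero (suc w))
... | yes (w , R0w) = k , c′ , (λ i → let (v , cv≡i) = c-onto i in suc v , cv≡i) , classes
  where
  c′ : Fin (suc n) → Fin k
  c′ zero = c w
  c′ (suc v) = c v
  classes : ∀ u v → (c′ u ≡ c′ v → R u v) × (R u v → c′ u ≡ c′ v)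
  classes zero zero = (λ _ → refl′ zero) , λ _ → refl
  classes zero (suc v) = (λ eq → trans′ R0w (proj₁ (c-classes w v) eq)) ,
                         λ R0v → proj₂ (c-classes w v) (trans′ (sym′ R0w) R0v)
  classes (suc u) zero = (λ eq → sym′ (trans′ R0w (proj₁ (c-classes w u) (sym eq)))) ,
                         λ Ru0 → sym (proj₂ (c-classes w u) (trans′ (sym′ R0w) (sym′ Ru0)))
  classes (suc u) (suc v) = c-classes u v
... | no ¬R0 = suc k , c′ , onto , classes
  where
  c′ : Fin (suc n) → Fin (suc k)
  c′ zero = zero
  c′ (suc v) = suc (c v)
  onto : ∀ i → ∃ λ v → c′ v ≡ i
  onto zero = zero , refl
  onto (suc i) = let (v , cv≡i) = c-onto i in suc v , cong suc cv≡i
  classes : ∀ u v → (c′ u ≡ c′ v → R u v) × (R u v → c′ u ≡ c′ v)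
  classes zero zero = (λ _ → refl′ zero) , λ _ → refl
  classes zero (suc v) = (λ ()) , λ R0v → ⊥-elim (¬R0 (v , R0v))
  classes (suc u) zero = (λ ()) , λ Ru0 → ⊥-elim (¬R0 (u , sym′ Ru0))
  classes (suc u) (suc v) = proj₁ (c-classes u v) ∘′ suc-injective , cong suc ∘′ proj₂ (c-classes u v)

data TwoCoincidences {k : ℕ} (f : Fin (suc (suc k)) → Fin k) : Set where
  three-equal : ∀ {i j l} → i ≢ j → i ≢ l → j ≢ l → f i ≡ f j → f i ≡ f l → TwoCoincidences f
  two-pairs   : ∀ {i j i′ j′} → i ≢ j → i′ ≢ j′ → f i ≡ f j → f i′ ≡ f j′ → f i ≢ f i′ → TwoCoincidences f

twoCoincidences : {k : ℕ} (f : Fin (suc (suc k)) → Fin k) → TwoCoincidences f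
twoCoincidences {k} f with pigeonhole (ℕ.m<n⇒m<1+n (ℕ.n<1+n k)) f
... | i , j , i<j , fi≡fj with pigeonhole (ℕ.n<1+n k) (f ∘′ punchIn j)
...   | x , y , x<y , fx≡fy with f (punchIn j x) ≟ f i
...     | no fx≢fi = two-pairs (<⇒≢ i<j) (<⇒≢ x<y ∘′ punchIn-injective j x y) fi≡fj fx≡fy (fx≢fi ∘′ sym)
...     | yes fx≡fi with punchIn j x ≟ i
...       | no x≢i = three-equal (<⇒≢ i<j) (x≢i ∘′ sym) (punchInᵢ≢i j x ∘′ sym) fi≡fj (sym fx≡fi)
...       | yes x≡i = three-equal (<⇒≢ i<j) (λ i≡y → <⇒≢ x<y (punchIn-injective j x y (trans x≡i i≡y)))
                        (punchInᵢ≢i j y ∘′ sym) fi≡fj (trans (sym fx≡fi) fx≡fy)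

module ComponentCount (G : Graph) where

  open Graph G using () renaming (src to s; tgt to t)
  open Walks G
  open Components G

  numComp-⊤ : ∃ λ k → NumComp G ⊤ k
  numComp-⊤ = labelling (nV G) (Reach G ⊤ ⊤) (reach? ⊤ ⊤) (λ _ → here ∈⊤) reach-sym reach-trans

  module _ {X : ESet G} (bondX : IsBond G X) where

    private
      Z : Vertex → VSet G
      Z = reachable (∁ X) ⊤

      x₀ : Edge
      x₀ = proj₁ (proj₁ (proj₂ bondX))

      x₀∈X : x₀ ∈ X
      x₀∈X = proj₂ (proj₁ (proj₂ bondX))

      δZ⊆X : ∀ {u} → δ G (Z u) ⊆ X
      δZ⊆X e∈ = x∉∁p⇒x∈p λ e∈∁X → reachable-closed e∈∁X ∈⊤ ∈⊤ e∈

      X⊆δZ : ∀ {u v} → Reach G ⊤ ⊤ u v → ¬ Reach G (∁ X) ⊤ u v → X ⊆ δ G (Z u)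
      X⊆δZ {u} r u↛v =
        let (e , _ , e∈δ , _) = exit (Z u) r (∈reachable⁺ (here ∈⊤)) (u↛v ∘′ ∈reachable⁻) in
        proj₂ (proj₂ bondX) (δ G (Z u)) (Z u , refl) (e , e∈δ) δZ⊆X

      Z-disjoint : ∀ {u v} → ¬ Reach G (∁ X) ⊤ u v → Disjoint (Z u) (Z v)
      Z-disjoint u↛v x∈ x∈′ = u↛v (reach-trans (∈reachable⁻ x∈) (reach-sym (∈reachable⁻ x∈′)))

      reach-x₀ : ∀ {u v} → Reach G ⊤ ⊤ u v → ¬ Reach G (∁ X) ⊤ u v → Reach G ⊤ ⊤ u (s x₀)
      reach-x₀ r u↛v with ∈δ⁻ (X⊆δZ r u↛v x₀∈X)
      ... | c₁ s∈Z _ = reach-mono ⊆⊤ (λ z → z) (∈reachable⁻ s∈Z)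
      ... | c₂ _ t∈Z = reach-trans (reach-mono ⊆⊤ (λ z → z) (∈reachable⁻ t∈Z)) (reach-sym (reach-link x₀))

    -- Two vertices of one component of G that are separated in G − X are separated by all of X
    -- (minimality), so an edge of X would cross three disjoint classes or join two components.
    bond-deletion-¬+2 : ∀ {k} → NumComp G ⊤ k → ¬ NumComp G (∁ X) (suc (suc k))
    bond-deletion-¬+2 (c , _ , c-classes) (c′ , c′-onto , c′-classes) = conclude (twoCoincidences (c ∘′ rep))
      where
      rep : Fin _ → Vertex
      rep i = proj₁ (c′-onto i)
      apart : ∀ {i j} → i ≢ j → ¬ Reach G (∁ X) ⊤ (rep i) (rep j)
      apart {i} {j} i≢j r = i≢j (trans (sym (proj₂ (c′-onto i))) (trans (proj₂ (c′-classes _ _) r) (proj₂ (c′-onto j))))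
      joined : ∀ {i j} → c (rep i) ≡ c (rep j) → Reach G ⊤ ⊤ (rep i) (rep j)
      joined = proj₁ (c-classes _ _)
      conclude : TwoCoincidences (c ∘′ rep) → ⊥′
      conclude (three-equal i≢j i≢l j≢l ci≡cj ci≡cl) =
        δ-three-disjoint (Z-disjoint (apart i≢j)) (Z-disjoint (apart i≢l)) (Z-disjoint (apart j≢l))
          (X⊆δZ (joined ci≡cj) (apart i≢j) x₀∈X)
          (X⊆δZ (reach-sym (joined ci≡cj)) (apart (i≢j ∘′ sym)) x₀∈X)
          (X⊆δZ (reach-sym (joined ci≡cl)) (apart (i≢l ∘′ sym)) x₀∈X)
      conclude (two-pairs i≢j i′≢j′ ci≡cj ci′≡cj′ ci≢ci′) =
        ci≢ci′ (proj₂ (c-classes _ _)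
          (reach-trans (reach-x₀ (joined ci≡cj) (apart i≢j)) (reach-sym (reach-x₀ (joined ci′≡cj′) (apart i′≢j′)))))

  -- The components of G − (δ A ∪ δ B) are labelled 0 for A, 1 for B, and 2 + c x for the others.
  module TwoNewComponents {k : ℕ} (nc : NumComp G ⊤ k) {A B : VSet G} (A#B : Disjoint A B)
    {a b : Vertex} (a∈A : a ∈ A) (b∈B : b ∈ B) (cA : Conn A) (cB : Conn B)
    (reach-outside : ∀ {u v} → u ∉ A → u ∉ B → v ∉ A → v ∉ B → Reach G ⊤ ⊤ u v → Reach G (∁ (δ G A ∪ δ G B)) ⊤ u v)
    (escape : ∀ {x} → x ∈ A ⊎ x ∈ B → ∃ λ w → w ∉ A × w ∉ B × Reach G ⊤ ⊤ x w) where

    private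
      T : ESet G
      T = δ G A ∪ δ G B
      c : Vertex → Fin k
      c = proj₁ nc
      c-onto : ∀ i → ∃ λ v → c v ≡ i
      c-onto = proj₁ (proj₂ nc)
      c-classes : ∀ u v → (c u ≡ c v → Reach G ⊤ ⊤ u v) × (Reach G ⊤ ⊤ u v → c u ≡ c v)
      c-classes = proj₂ (proj₂ nc)

      data Kind (x : Vertex) : Fin (suc (suc k)) → Set where
        inA : x ∈ A → Kind x zero
        inB : x ∈ B → Kind x (suc zero)
        out : x ∉ A → x ∉ B → Kind x (suc (suc (c x)))

      kind : ∀ x → ∃ (Kind x)
      kind x with x ∈? A | x ∈? B
      ... | yes x∈A | _ = _ , inA x∈A
      ... | no _ | yes x∈B = _ , inB x∈B
      ... | no x∉A | no x∉B = _ , out x∉A x∉B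

      label : Vertex → Fin (suc (suc k))
      label x = proj₁ (kind x)

      label-A : ∀ {x} → x ∈ A → label x ≡ zero
      label-A {x} x∈A with kind x
      ... | _ , inA _ = refl
      ... | _ , inB x∈B = ⊥-elim (A#B x∈A x∈B)
      ... | _ , out x∉A _ = ⊥-elim (x∉A x∈A)

      label-B : ∀ {x} → x ∈ B → label x ≡ suc zero
      label-B {x} x∈B with kind x
      ... | _ , inA x∈A = ⊥-elim (A#B x∈A x∈B)
      ... | _ , inB _ = refl
      ... | _ , out _ x∉B = ⊥-elim (x∉B x∈B)

      label-out : ∀ {x} → x ∉ A → x ∉ B → label x ≡ suc (suc (c x))
      label-out {x} x∉A x∉B with kind x
      ... | _ , inA x∈A = ⊥-elim (x∉A x∈A)
      ... | _ , inB x∈B = ⊥-elim (x∉B x∈B)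
      ... | _ , out _ _ = refl

      adj-label : ∀ {x y} → Adj G (∁ T) ⊤ x y → label x ≡ label y
      adj-label {x} {y} ab@(e , e∈∁T , _) = compare (kind x) (kind y)
        where
        e∉T : e ∉ T
        e∉T = x∈∁p⇒x∉p e∈∁T
        leaves-A : x ∈ A → y ∉ A → ⊥′
        leaves-A x∈ y∉ = e∉T (x∈p∪q⁺ (inj₁ (∈δ⁺ (adj-cross ab x∈ y∉))))
        enters-A : x ∉ A → y ∈ A → ⊥′
        enters-A x∉ y∈ = e∉T (x∈p∪q⁺ (inj₁ (∈δ⁺ (cross-sym (adj-cross ab x∉ y∈)))))
        leaves-B : x ∈ B → y ∉ B → ⊥′
        leaves-B x∈ y∉ = e∉T (x∈p∪q⁺ (inj₂ (∈δ⁺ (adj-cross ab x∈ y∉))))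
        enters-B : x ∉ B → y ∈ B → ⊥′
        enters-B x∉ y∈ = e∉T (x∈p∪q⁺ (inj₂ (∈δ⁺ (cross-sym (adj-cross ab x∉ y∈)))))
        compare : (kx : ∃ (Kind x)) (ky : ∃ (Kind y)) → proj₁ kx ≡ proj₁ ky
        compare (_ , inA _) (_ , inA _) = refl
        compare (_ , inB _) (_ , inB _) = refl
        compare (_ , out _ _) (_ , out _ _) =
          cong (suc ∘′ suc) (proj₂ (c-classes x y) (reach-mono ⊆⊤ (λ z → z) (reach-adj ab)))
        compare (_ , inA x∈) (_ , inB y∈) = ⊥-elim (leaves-A x∈ (λ y∈A → A#B y∈A y∈))
        compare (_ , inA x∈) (_ , out y∉ _) = ⊥-elim (leaves-A x∈ y∉)
        compare (_ , inB x∈) (_ , inA y∈) = ⊥-elim (enters-A (λ x∈A → A#B x∈A x∈) y∈)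
        compare (_ , out x∉ _) (_ , inA y∈) = ⊥-elim (enters-A x∉ y∈)
        compare (_ , inB x∈) (_ , out _ y∉) = ⊥-elim (leaves-B x∈ y∉)
        compare (_ , out _ x∉) (_ , inB y∈) = ⊥-elim (enters-B x∉ y∈)

      reach-label : ∀ {x y} → Reach G (∁ T) ⊤ x y → label x ≡ label y
      reach-label (here _) = refl
      reach-label (step r ab) = trans (reach-label r) (adj-label ab)

      label-reach : ∀ u v → label u ≡ label v → Reach G (∁ T) ⊤ u v
      label-reach u v = compare (kind u) (kind v)
        where
        compare : (ku : ∃ (Kind u)) (kv : ∃ (Kind v)) → proj₁ ku ≡ proj₁ kv → Reach G (∁ T) ⊤ u v
        compare (_ , inA u∈) (_ , inA v∈) _ =
          reach-avoiding (inside-∉δ∪δ (inj₁ (λ x∈ → x∈)) (inj₂ A#B)) (cA u v u∈ v∈)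
        compare (_ , inB u∈) (_ , inB v∈) _ =
          reach-avoiding (inside-∉δ∪δ (inj₂ (disjoint-sym A#B)) (inj₁ (λ x∈ → x∈))) (cB u v u∈ v∈)
        compare (_ , out u∉A u∉B) (_ , out v∉A v∉B) eq =
          reach-outside u∉A u∉B v∉A v∉B (proj₁ (c-classes u v) (suc-injective (suc-injective eq)))
        compare (_ , inA _) (_ , inB _) ()
        compare (_ , inA _) (_ , out _ _) ()
        compare (_ , inB _) (_ , inA _) ()
        compare (_ , inB _) (_ , out _ _) ()
        compare (_ , out _ _) (_ , inA _) ()
        compare (_ , out _ _) (_ , inB _) ()

      outside-of : ∀ x → ∃ λ w → w ∉ A × w ∉ B × Reach G ⊤ ⊤ x w
      outside-of x with x ∈? A | x ∈? B
      ... | yes x∈A | _ = escape (inj₁ x∈A)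
      ... | no _ | yes x∈B = escape (inj₂ x∈B)
      ... | no x∉A | no x∉B = x , x∉A , x∉B , here ∈⊤

      label-onto : ∀ i → ∃ λ v → label v ≡ i
      label-onto zero = a , label-A a∈A
      label-onto (suc zero) = b , label-B b∈B
      label-onto (suc (suc i)) =
        let (x , cx≡i) = c-onto i
            (w , w∉A , w∉B , x~w) = outside-of x
        in w , trans (label-out w∉A w∉B) (cong (suc ∘′ suc) (trans (sym (proj₂ (c-classes x w) x~w)) cx≡i))

    numComp : NumComp G (∁ (δ G A ∪ δ G B)) (suc (suc k))
    numComp = label , label-onto , λ u v → label-reach u v , reach-label

module Tribonds (G : Graph) where

  open Graph G using () renaming (src to s; tgt to t)
  open Walks G
  open Components G
  open Splitting G
  open ComponentCount G

  tribond-in-component : {T : ESet G} {e₁ e₂ : Edge} → IsTribond G T → e₁ ∈ T → e₂ ∈ T → Reach G ⊤ ⊤ (s e₁) (s e₂)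
  tribond-in-component {T} (P , refl) e₁∈ e₂∈ =
    reach-mono (λ e∈ → e∈) ⊆⊤ (proj₂ (proj₁ comp) _ _ (src∈K e₁∈) (src∈K e₂∈))
    where
    open Tripartition P
    K : VSet G
    K = X₁ ∪ (X₂ ∪ X₃)
    end∈K : ∀ {W e} → W ⊆ K → e ∈ δ G W → s e ∈ K ⊎ t e ∈ K
    end∈K W⊆K e∈ with ∈δ⁻ e∈
    ... | c₁ s∈ _ = inj₁ (W⊆K s∈)
    ... | c₂ _ t∈ = inj₂ (W⊆K t∈)
    src∈K : ∀ {e} → e ∈ T → s e ∈ K
    src∈K {e} e∈ = proj₁ (isolated-ends (δ≡⊥⇒isolated (proj₂ comp)) (case (∈∪⁻ e∈)))
      where
      case : e ∈ δ G X₁ ⊎ e ∈ δ G X₂ ∪ δ G X₃ → s e ∈ K ⊎ t e ∈ K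
      case (inj₁ e∈₁) = end∈K (p⊆p∪q _) e∈₁
      case (inj₂ e∈₂₃) with ∈∪⁻ e∈₂₃
      ... | inj₁ e∈₂ = end∈K (q⊆p∪q X₁ _ ∘′ p⊆p∪q _) e∈₂
      ... | inj₂ e∈₃ = end∈K (q⊆p∪q X₁ _ ∘′ q⊆p∪q X₂ X₃) e∈₃

  module _ {A B : VSet G} (A#B : Disjoint A B) (no-AB : ∀ {e} → ¬ Cross (_∈ A) (_∈ B) e) where

    private
      T : ESet G
      T = δ G A ∪ δ G B

      Out : Vertex → Set
      Out x = x ∉ A × x ∉ B

      AllOut AllIn : VSet G → Set
      AllOut X = ∀ {x} → x ∈ X → Out x
      AllIn X = ∀ {x} → x ∈ X → ¬ Out x

      Avoids-T : VSet G → Set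
      Avoids-T X = ∀ {e} → s e ∈ X → t e ∈ X → e ∉ T

      one-end-out : ∀ {e} → e ∈ T → Cross Out (¬_ ∘′ Out) e
      one-end-out e∈ with ∈∪⁻ e∈
      ... | inj₁ e∈δA with ∈δ⁻ e∈δA
      ...   | c₁ s∈A t∉A = c₂ (λ (s∉A , _) → s∉A s∈A) (t∉A , λ t∈B → no-AB (c₁ s∈A t∈B))
      ...   | c₂ s∉A t∈A = c₁ (s∉A , λ s∈B → no-AB (c₂ s∈B t∈A)) (λ (t∉A , _) → t∉A t∈A)
      one-end-out e∈ | inj₂ e∈δB with ∈δ⁻ e∈δB
      ...   | c₁ s∈B t∉B = c₂ (λ (_ , s∉B) → s∉B s∈B) ((λ t∈A → no-AB (c₂ s∈B t∈A)) , t∉B)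
      ...   | c₂ s∉B t∈B = c₁ ((λ s∈A → no-AB (c₁ s∈A t∈B)) , s∉B) (λ (_ , t∉B) → t∉B t∈B)

      avoids-δ : ∀ {X W} → Avoids-T X → δ G W ⊆ T → ∀ {e} → s e ∈ X → t e ∈ X → e ∉ δ G W
      avoids-δ X-avoids-T δW⊆T s∈ t∈ = X-avoids-T s∈ t∈ ∘′ δW⊆T

      side : ∀ {X} → Connected G X → Avoids-T X → AllOut X ⊎ AllIn X
      side ((r , r∈) , cX) X-avoids-T with r ∈? A | r ∈? B
      ... | yes r∈A | _ = inj₂ λ x∈ (x∉A , _) → x∉A (conn-inside cX (avoids-δ X-avoids-T (x∈p∪q⁺ ∘′ inj₁)) r∈ x∈ r∈A)
      ... | no _ | yes r∈B = inj₂ λ x∈ (_ , x∉B) → x∉B (conn-inside cX (avoids-δ X-avoids-T (x∈p∪q⁺ ∘′ inj₂)) r∈ x∈ r∈B)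
      ... | no r∉A | no r∉B = inj₁ λ x∈ →
        (λ x∈A → r∉A (conn-inside cX (avoids-δ X-avoids-T (x∈p∪q⁺ ∘′ inj₁)) x∈ r∈ x∈A)) ,
        (λ x∈B → r∉B (conn-inside cX (avoids-δ X-avoids-T (x∈p∪q⁺ ∘′ inj₂)) x∈ r∈ x∈B))

      opposite : ∀ {X Y} (j : Joins G X Y) → proj₁ j ∈ T → ¬ ((AllOut X × AllOut Y) ⊎ (AllIn X × AllIn Y))
      opposite j j∈T (inj₁ (outX , outY)) with one-end-out j∈T | cross-both (cross-map outX outY (joins⇒cross j))
      ... | c₁ _ ¬out | (_ , out) = ¬out out
      ... | c₂ ¬out _ | (out , _) = ¬out out
      opposite j j∈T (inj₂ (inX , inY)) with one-end-out j∈T | cross-both (cross-map inX inY (joins⇒cross j))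
      ... | c₁ out _ | (¬out , _) = ¬out out
      ... | c₂ _ out | (_ , ¬out) = ¬out out

    -- Every edge of δ A ∪ δ B has exactly one end outside A ∪ B, so on the three parts of a
    -- tribond "lying outside A ∪ B" would have to alternate along a triangle.
    δ∪δ-not-tribond : ¬ IsTribond G (δ G A ∪ δ G B)
    δ∪δ-not-tribond (P , T≡) = conclude (side conn₁ X₁-avoids-T) (side conn₂ X₂-avoids-T) (side conn₃ X₃-avoids-T)
      where
      open Tripartition P

      part-avoids-T : ∀ {X} → X ⊆ X₁ ⊎ Disjoint X X₁ → X ⊆ X₂ ⊎ Disjoint X X₂ → X ⊆ X₃ ⊎ Disjoint X X₃ → Avoids-T X
      part-avoids-T X₁? X₂? X₃? s∈ t∈ e∈ with ∈∪⁻ (subst (_ ∈_) T≡ e∈)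
      ... | inj₁ e∈₁ = inside-∉δ X₁? s∈ t∈ e∈₁
      ... | inj₂ e∈₂₃ = inside-∉δ∪δ X₂? X₃? s∈ t∈ e∈₂₃

      X₁#X₂ : Disjoint X₁ X₂
      X₁#X₂ = ∩≡⊥⇒disjoint disj₁₂
      X₁#X₃ : Disjoint X₁ X₃
      X₁#X₃ = ∩≡⊥⇒disjoint disj₁₃
      X₂#X₃ : Disjoint X₂ X₃
      X₂#X₃ = ∩≡⊥⇒disjoint disj₂₃

      X₁-avoids-T : Avoids-T X₁
      X₁-avoids-T = part-avoids-T (inj₁ (λ x∈ → x∈)) (inj₂ X₁#X₂) (inj₂ X₁#X₃)
      X₂-avoids-T : Avoids-T X₂
      X₂-avoids-T = part-avoids-T (inj₂ (disjoint-sym X₁#X₂)) (inj₁ (λ x∈ → x∈)) (inj₂ X₂#X₃)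
      X₃-avoids-T : Avoids-T X₃
      X₃-avoids-T = part-avoids-T (inj₂ (disjoint-sym X₁#X₃)) (inj₂ (disjoint-sym X₂#X₃)) (inj₁ (λ x∈ → x∈))

      joining-∈T : ∀ {X Y} (j : Joins G X Y) → Disjoint X Y → δ G X ⊆ T → proj₁ j ∈ T
      joining-∈T j X#Y δX⊆T = δX⊆T (∈δ⁺ (cross-map (λ x∈ → x∈) (λ y∈ x∈ → X#Y x∈ y∈) (joins⇒cross j)))

      δ₁⊆T : δ G X₁ ⊆ T
      δ₁⊆T e∈ = subst (_ ∈_) (sym T≡) (x∈p∪q⁺ (inj₁ e∈))
      δ₂⊆T : δ G X₂ ⊆ T
      δ₂⊆T e∈ = subst (_ ∈_) (sym T≡) (x∈p∪q⁺ (inj₂ (x∈p∪q⁺ (inj₁ e∈))))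

      conclude : AllOut X₁ ⊎ AllIn X₁ → AllOut X₂ ⊎ AllIn X₂ → AllOut X₃ ⊎ AllIn X₃ → ⊥′
      conclude (inj₁ o₁) (inj₁ o₂) _ = opposite join₁₂ (joining-∈T join₁₂ X₁#X₂ δ₁⊆T) (inj₁ (o₁ , o₂))
      conclude (inj₂ i₁) (inj₂ i₂) _ = opposite join₁₂ (joining-∈T join₁₂ X₁#X₂ δ₁⊆T) (inj₂ (i₁ , i₂))
      conclude (inj₁ o₁) (inj₂ _) (inj₁ o₃) = opposite join₁₃ (joining-∈T join₁₃ X₁#X₃ δ₁⊆T) (inj₁ (o₁ , o₃))
      conclude (inj₂ i₁) (inj₁ _) (inj₂ i₃) = opposite join₁₃ (joining-∈T join₁₃ X₁#X₃ δ₁⊆T) (inj₂ (i₁ , i₃))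
      conclude (inj₁ _) (inj₂ i₂) (inj₂ i₃) = opposite join₂₃ (joining-∈T join₂₃ X₂#X₃ δ₂⊆T) (inj₂ (i₂ , i₃))
      conclude (inj₂ _) (inj₁ o₂) (inj₁ o₃) = opposite join₂₃ (joining-∈T join₂₃ X₂#X₃ δ₂⊆T) (inj₁ (o₂ , o₃))

  TriOrDibondAvoiding : ESet G → Set
  TriOrDibondAvoiding F = ∃ λ T → (IsTribond G T ⊎ IsDibond G T) × T ⊆ ∁ F

  record ThreeParts (C A M B : VSet G) : Set where
    field
      isoC     : Isolated C
      connC    : Conn C
      cover    : ∀ {x} → x ∈ C → x ∈ A ⊎ x ∈ M ⊎ x ∈ B
      A⊆C      : A ⊆ C
      M⊆C      : M ⊆ C
      B⊆C      : B ⊆ C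
      A#M      : Disjoint A M
      A#B      : Disjoint A B
      M#B      : Disjoint M B
      connA    : Conn A
      connM    : Conn M
      connB    : Conn B
      a m b    : Vertex
      a∈A      : a ∈ A
      m∈M      : m ∈ M
      b∈B      : b ∈ B

    ∪≡C : A ∪ (M ∪ B) ≡ C
    ∪≡C = ⊆-antisym (∪-least A⊆C (∪-least M⊆C B⊆C)) C⊆∪
      where
      C⊆∪ : C ⊆ A ∪ (M ∪ B)
      C⊆∪ x∈ with cover x∈
      ... | inj₁ x∈A = x∈p∪q⁺ (inj₁ x∈A)
      ... | inj₂ (inj₁ x∈M) = x∈p∪q⁺ (inj₂ (x∈p∪q⁺ (inj₁ x∈M)))
      ... | inj₂ (inj₂ x∈B) = x∈p∪q⁺ (inj₂ (x∈p∪q⁺ (inj₂ x∈B)))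

    isComponent : IsComponent G (A ∪ (M ∪ B))
    isComponent = subst (IsComponent G) (sym ∪≡C) (((a , A⊆C a∈A) , connC) , isolated⇒δ≡⊥ isoC)

    tripartition : ∀ {j₁ j₂ j₃} → Cross (_∈ A) (_∈ M) j₁ → Cross (_∈ A) (_∈ B) j₂ → Cross (_∈ M) (_∈ B) j₃ → Tripartition G
    tripartition jAM jAB jMB = record
      { X₁ = A ; X₂ = M ; X₃ = B
      ; comp = isComponent
      ; disj₁₂ = disjoint⇒∩≡⊥ A#M ; disj₁₃ = disjoint⇒∩≡⊥ A#B ; disj₂₃ = disjoint⇒∩≡⊥ M#B
      ; conn₁ = (a , a∈A) , connA ; conn₂ = (m , m∈M) , connM ; conn₃ = (b , b∈B) , connB
      ; join₁₂ = cross⇒joins jAM ; join₁₃ = cross⇒joins jAB ; join₂₃ = cross⇒joins jMB }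

    tribond : ∀ {j₁ j₂ j₃} → Cross (_∈ A) (_∈ M) j₁ → Cross (_∈ A) (_∈ B) j₂ → Cross (_∈ M) (_∈ B) j₃ →
              IsTribond G (δ G A ∪ (δ G M ∪ δ G B))
    tribond jAM jAB jMB = tripartition jAM jAB jMB , refl

    leaveA : ∀ {e} → Cross (_∈ A) (_∉ A) e → Cross (_∈ A) (_∈ M ∪ B) e
    leaveA = cross-map (λ x∈ → x∈) rest ∘′ leave-isolated isoC A⊆C
      where
      rest : ∀ {x} → x ∉ A × x ∈ C → x ∈ M ∪ B
      rest (x∉A , x∈C) with cover x∈C
      ... | inj₁ x∈A = ⊥-elim (x∉A x∈A)
      ... | inj₂ x∈MB = x∈p∪q⁺ x∈MB

    leaveB : ∀ {e} → Cross (_∈ B) (_∉ B) e → Cross (_∈ B) (_∈ A ∪ M) e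
    leaveB = cross-map (λ x∈ → x∈) rest ∘′ leave-isolated isoC B⊆C
      where
      rest : ∀ {x} → x ∉ B × x ∈ C → x ∈ A ∪ M
      rest (x∉B , x∈C) with cover x∈C
      ... | inj₁ x∈A = x∈p∪q⁺ (inj₁ x∈A)
      ... | inj₂ (inj₁ x∈M) = x∈p∪q⁺ (inj₂ x∈M)
      ... | inj₂ (inj₂ x∈B) = ⊥-elim (x∉B x∈B)

    module _ {j₁ j₂} (jAM : Cross (_∈ A) (_∈ M) j₁) (jMB : Cross (_∈ M) (_∈ B) j₂) where

      δA-isBond : IsBond G (δ G A)
      δA-isBond = isBond-δ A (M ∪ B) (λ x∈A x∈MB → [ A#M x∈A , A#B x∈A ]′ (∈∪⁻ x∈MB)) connA (conn-∪ connM connB jMB)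
                    (cross-map (λ x∈ → x∈) (λ x∈M → x∈p∪q⁺ (inj₁ x∈M)) jAM) leaveA

      δB-isBond : IsBond G (δ G B)
      δB-isBond = isBond-δ B (A ∪ M) (λ x∈B x∈AM → [ (λ x∈A → A#B x∈A x∈B) , (λ x∈M → M#B x∈M x∈B) ]′ (∈∪⁻ x∈AM)) connB
                    (conn-∪ connA connM jAM) (cross-map (λ x∈ → x∈) (λ x∈M → x∈p∪q⁺ (inj₂ x∈M)) (cross-sym jMB)) leaveB

    dibond : ∀ {j₁ j₂} → Cross (_∈ A) (_∈ M) j₁ → Cross (_∈ M) (_∈ B) j₂ → (∀ {e} → ¬ Cross (_∈ A) (_∈ B) e) →
             IsDibond G (δ G A ∪ δ G B)
    dibond jAM jMB no-AB =
      (δ G A , δ G B ,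
        (δA-isBond jAM jMB , δB-isBond jAM jMB , proj₁ numComp-⊤ , proj₂ numComp-⊤ ,
         TwoNewComponents.numComp (proj₂ numComp-⊤) A#B a∈A b∈B connA connB reach-outside escape) , refl) ,
      δ∪δ-not-tribond A#B no-AB
      where
      toM : ∀ {x} → x ∉ A → x ∉ B → x ∈ C → x ∈ M
      toM x∉A x∉B x∈C with cover x∈C
      ... | inj₁ x∈A = ⊥-elim (x∉A x∈A)
      ... | inj₂ (inj₁ x∈M) = x∈M
      ... | inj₂ (inj₂ x∈B) = ⊥-elim (x∉B x∈B)
      reach-outside : ∀ {u v} → u ∉ A → u ∉ B → v ∉ A → v ∉ B → Reach G ⊤ ⊤ u v → Reach G (∁ (δ G A ∪ δ G B)) ⊤ u v
      reach-outside {u} {v} u∉A u∉B v∉A v∉B r with u ∈? C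
      ... | yes u∈C = reach-avoiding (inside-∉δ∪δ (inj₂ (disjoint-sym A#M)) (inj₂ M#B))
                        (connM u v (toM u∉A u∉B u∈C) (toM v∉A v∉B (reach-stays C (λ _ → isoC) r u∈C)))
      ... | no u∉C =
        reach-avoiding (inside-∉δ∪δ (inj₂ (⊆∁⇒disjoint A⊆C (p∩q⊆q _ _))) (inj₂ (⊆∁⇒disjoint B⊆C (p∩q⊆q _ _))))
          (reach-off-isolated C isoC u∉C r)
      escape : ∀ {x} → x ∈ A ⊎ x ∈ B → ∃ λ w → w ∉ A × w ∉ B × Reach G ⊤ ⊤ x w
      escape {x} x∈AB =
        m , (λ m∈A → A#M m∈A m∈M) , M#B m∈M , reach-mono (λ e∈ → e∈) ⊆⊤ (connC x m ([ A⊆C , B⊆C ]′ x∈AB) (M⊆C m∈M))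

  swap-last : ∀ {C A M B} → ThreeParts C A M B → ThreeParts C A B M
  swap-last tp = record
    { isoC = isoC ; connC = connC ; cover = Sum.map₂ Sum.swap ∘′ cover
    ; A⊆C = A⊆C ; M⊆C = B⊆C ; B⊆C = M⊆C ; A#M = A#B ; A#B = A#M ; M#B = disjoint-sym M#B
    ; connA = connA ; connM = connB ; connB = connM ; a∈A = a∈A ; m∈M = b∈B ; b∈B = m∈M }
    where open ThreeParts tp

  -- With C = P ∪ Q and Q = Y ∪ Z: a tribond if P is joined to both Y and Z, otherwise a dibond
  -- along the path P–Y–Z or P–Z–Y.
  module NestedSplit {C : VSet G} {F : ESet G} {u v w : Vertex} (isoC : Isolated C) (connC : Conn C)
    (sp₁ : Split C F u v) (sp₂ : Split (Split.X₂ sp₁) F v w) where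

    private
      module S₁ = Split sp₁
      module S₂ = Split sp₂
      P Q Y Z : VSet G
      P = S₁.X₁
      Q = S₁.X₂
      Y = S₂.X₁
      Z = S₂.X₂

      parts : ThreeParts C P Y Z
      parts = record
        { isoC = isoC ; connC = connC ; cover = Sum.map₂ S₂.cover ∘′ S₁.cover
        ; A⊆C = S₁.X₁⊆S ; M⊆C = S₁.X₂⊆S ∘′ S₂.X₁⊆S ; B⊆C = S₁.X₂⊆S ∘′ S₂.X₂⊆S
        ; A#M = λ x∈P → S₁.X₁#X₂ x∈P ∘′ S₂.X₁⊆S ; A#B = λ x∈P → S₁.X₁#X₂ x∈P ∘′ S₂.X₂⊆S ; M#B = S₂.X₁#X₂
        ; connA = S₁.conn₁ ; connM = S₂.conn₁ ; connB = S₂.conn₂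
        ; a∈A = S₁.u∈X₁ ; m∈M = S₂.u∈X₁ ; b∈B = S₂.v∈X₂ }

      δC⊆∁F : δ G C ⊆ ∁ F
      δC⊆∁F e∈ = ⊥-elim (isoC e∈)
      δQ⊆∁F : δ G Q ⊆ ∁ F
      δQ⊆∁F = Split.δX₁⊆∁F (split-swap sp₁) δC⊆∁F
      δP⊆∁F : δ G P ⊆ ∁ F
      δP⊆∁F = S₁.δX₁⊆∁F δC⊆∁F
      δY⊆∁F : δ G Y ⊆ ∁ F
      δY⊆∁F = S₂.δX₁⊆∁F δQ⊆∁F
      δZ⊆∁F : δ G Z ⊆ ∁ F
      δZ⊆∁F = Split.δX₁⊆∁F (split-swap sp₂) δQ⊆∁F

      from-joins : ∀ {j₀ j₁} → Cross (_∈ P) (λ x → x ∈ Y ⊎ x ∈ Z) j₀ → Cross (_∈ Y) (_∈ Z) j₁ → TriOrDibondAvoiding F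
      from-joins jPQ jYZ with cross-split jPQ | any? (cross? P Z) | any? (cross? P Y)
      ... | inj₁ jPY | yes (_ , jPZ) | _ =
        _ , inj₁ (ThreeParts.tribond parts jPY jPZ jYZ) , ∪-least δP⊆∁F (∪-least δY⊆∁F δZ⊆∁F)
      ... | inj₁ jPY | no ¬jPZ | _ =
        _ , inj₂ (ThreeParts.dibond parts jPY jYZ (λ jPZ → ¬jPZ (_ , jPZ))) , ∪-least δP⊆∁F δZ⊆∁F
      ... | inj₂ jPZ | _ | yes (_ , jPY) =
        _ , inj₁ (ThreeParts.tribond parts jPY jPZ jYZ) , ∪-least δP⊆∁F (∪-least δY⊆∁F δZ⊆∁F)
      ... | inj₂ jPZ | _ | no ¬jPY =
        _ , inj₂ (ThreeParts.dibond (swap-last parts) jPZ (cross-sym jYZ) (λ jPY → ¬jPY (_ , jPY))) , ∪-least δP⊆∁F δY⊆∁F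

    triOrDibond : TriOrDibondAvoiding F
    triOrDibond =
      from-joins (cross-map (λ x∈ → x∈) S₂.cover (proj₂ (S₁.joining-edge connC))) (proj₂ (S₂.joining-edge S₁.conn₂))

  three-separated : (F : ESet G) {u v w : Vertex} → Reach G ⊤ ⊤ u v → Reach G ⊤ ⊤ u w →
                    ¬ Reach G F ⊤ u v → ¬ Reach G F ⊤ u w → ¬ Reach G F ⊤ v w → TriOrDibondAvoiding F
  three-separated F {u} {v} {w} u~v u~w u↛v u↛w v↛w = finish (Split.cover sp (∈reachable⁺ u~w))
    where
    sp : Split (component u) F u v
    sp = split reachable-conn (∈reachable⁺ (here ∈⊤)) (∈reachable⁺ u~v) (u↛v ∘′ reach-mono (λ e∈ → e∈) ⊆⊤)
    open Split sp
    finish : w ∈ X₁ ⊎ w ∈ X₂ → TriOrDibondAvoiding F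
    finish (inj₁ w∈X₁) = NestedSplit.triOrDibond component-isolated reachable-conn (split-swap sp)
                           (split conn₁ u∈X₁ w∈X₁ (u↛w ∘′ reach-mono (λ e∈ → e∈) ⊆⊤))
    finish (inj₂ w∈X₂) = NestedSplit.triOrDibond component-isolated reachable-conn sp
                           (split conn₂ v∈X₂ w∈X₂ (v↛w ∘′ reach-mono (λ e∈ → e∈) ⊆⊤))

  -- The cuts splitting the components of u₁ and of v₁ across no edge of F form a dibond.
  module TwoComponents (F : ESet G) {u₁ u₂ v₁ v₂ : Vertex} (u₁~u₂ : Reach G ⊤ ⊤ u₁ u₂) (v₁~v₂ : Reach G ⊤ ⊤ v₁ v₂)
    (u₁↛u₂ : ¬ Reach G F ⊤ u₁ u₂) (v₁↛v₂ : ¬ Reach G F ⊤ v₁ v₂) (u₁≁v₁ : ¬ Reach G ⊤ ⊤ u₁ v₁) where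

    private
      C₁ C₂ : VSet G
      C₁ = component u₁
      C₂ = component v₁
      spA : Split C₁ F u₁ u₂
      spA = split reachable-conn (∈reachable⁺ (here ∈⊤)) (∈reachable⁺ u₁~u₂) (u₁↛u₂ ∘′ reach-mono (λ e∈ → e∈) ⊆⊤)
      spB : Split C₂ F v₁ v₂
      spB = split reachable-conn (∈reachable⁺ (here ∈⊤)) (∈reachable⁺ v₁~v₂) (v₁↛v₂ ∘′ reach-mono (λ e∈ → e∈) ⊆⊤)
      module SA = Split spA
      module SB = Split spB
      A B : VSet G
      A = SA.X₁
      B = SB.X₁

      δ⊆∁F : ∀ {C} → δ G (component C) ⊆ ∁ F
      δ⊆∁F e∈ = ⊥-elim (component-isolated e∈)

      C₁#C₂ : Disjoint C₁ C₂
      C₁#C₂ x∈₁ x∈₂ = u₁≁v₁ (reach-trans (∈reachable⁻ x∈₁) (reach-sym (∈reachable⁻ x∈₂)))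

      reach-outside : ∀ {u v} → u ∉ A → u ∉ B → v ∉ A → v ∉ B → Reach G ⊤ ⊤ u v → Reach G (∁ (δ G A ∪ δ G B)) ⊤ u v
      reach-outside {u} {v} u∉A u∉B v∉A v∉B r with u ∈? C₁ | u ∈? C₂
      ... | yes u∈C₁ | _ =
        reach-avoiding (inside-∉δ∪δ (inj₂ (disjoint-sym SA.X₁#X₂)) (inj₂ λ x∈ x∈B → C₁#C₂ (SA.X₂⊆S x∈) (SB.X₁⊆S x∈B)))
          (SA.conn₂ u v (SA.to₂ u∈C₁ u∉A) (SA.to₂ (reach-stays C₁ (λ _ → component-isolated) r u∈C₁) v∉A))
      ... | no _ | yes u∈C₂ =
        reach-avoiding (inside-∉δ∪δ (inj₂ λ x∈ x∈A → C₁#C₂ (SA.X₁⊆S x∈A) (SB.X₂⊆S x∈)) (inj₂ (disjoint-sym SB.X₁#X₂)))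
          (SB.conn₂ u v (SB.to₂ u∈C₂ u∉B) (SB.to₂ (reach-stays C₂ (λ _ → component-isolated) r u∈C₂) v∉B))
      ... | no u∉C₁ | no u∉C₂ =
        reach-avoiding (inside-∉δ∪δ (inj₂ (⊆∁⇒disjoint SA.X₁⊆S (p∩q⊆q _ _ ∘′ p∩q⊆p _ _)))
                                    (inj₂ (⊆∁⇒disjoint SB.X₁⊆S (p∩q⊆q _ _))))
          (reach-off-isolated C₂ component-isolated u∉C₂ (reach-off-isolated C₁ component-isolated u∉C₁ r))

      escape : ∀ {x} → x ∈ A ⊎ x ∈ B → ∃ λ w → w ∉ A × w ∉ B × Reach G ⊤ ⊤ x w
      escape {x} (inj₁ x∈A) = u₂ , (λ u₂∈A → SA.X₁#X₂ u₂∈A SA.v∈X₂) , (λ u₂∈B → C₁#C₂ (SA.X₂⊆S SA.v∈X₂) (SB.X₁⊆S u₂∈B)) ,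
        reach-mono (λ e∈ → e∈) ⊆⊤ (reachable-conn x u₂ (SA.X₁⊆S x∈A) (SA.X₂⊆S SA.v∈X₂))
      escape {x} (inj₂ x∈B) = v₂ , (λ v₂∈A → C₁#C₂ (SA.X₁⊆S v₂∈A) (SB.X₂⊆S SB.v∈X₂)) , (λ v₂∈B → SB.X₁#X₂ v₂∈B SB.v∈X₂) ,
        reach-mono (λ e∈ → e∈) ⊆⊤ (reachable-conn x v₂ (SB.X₁⊆S x∈B) (SB.X₂⊆S SB.v∈X₂))

    bonds : ∃ λ B₁ → ∃ λ B₂ → ModularPair G B₁ B₂ × δ G A ∪ δ G B ≡ B₁ ∪ B₂
    bonds = δ G A , δ G B ,
      (SA.δX₁-isBond component-isolated reachable-conn , SB.δX₁-isBond component-isolated reachable-conn ,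
       proj₁ numComp-⊤ , proj₂ numComp-⊤ ,
       TwoNewComponents.numComp (proj₂ numComp-⊤) (λ x∈A x∈B → C₁#C₂ (SA.X₁⊆S x∈A) (SB.X₁⊆S x∈B))
         SA.u∈X₁ SB.u∈X₁ SA.conn₁ SB.conn₁ reach-outside escape) , refl

    not-tribond : ¬ IsTribond G (δ G A ∪ δ G B)
    not-tribond tri =
      let (e₁ , e₁∈δA , s₁∈C₁) = SA.δX₁-edge reachable-conn
          (e₂ , e₂∈δB , s₂∈C₂) = SB.δX₁-edge reachable-conn
      in u₁≁v₁ (reach-trans (∈reachable⁻ s₁∈C₁)
                  (reach-trans (tribond-in-component tri (x∈p∪q⁺ (inj₁ e₁∈δA)) (x∈p∪q⁺ (inj₂ e₂∈δB)))
                     (reach-sym (∈reachable⁻ s₂∈C₂))))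

    dibond-avoiding : TriOrDibondAvoiding F
    dibond-avoiding = δ G A ∪ δ G B , inj₂ (bonds , not-tribond) , ∪-least (SA.δX₁⊆∁F δ⊆∁F) (SB.δX₁⊆∁F δ⊆∁F)

  two-separated : (F : ESet G) {u₁ u₂ v₁ v₂ : Vertex} → Reach G ⊤ ⊤ u₁ u₂ → Reach G ⊤ ⊤ v₁ v₂ →
                  ¬ Reach G F ⊤ u₁ u₂ → ¬ Reach G F ⊤ v₁ v₂ → ¬ Reach G ⊤ ⊤ u₁ v₁ → TriOrDibondAvoiding F
  two-separated = TwoComponents.dibond-avoiding

  -- Either e and x₀ lie in different components, or three of their ends are pairwise
  -- separated in F ∖ e.
  exchange : (F : ESet G) {e x₀ : Edge} → e ∈ F → ¬ Reach G (F ∖ e) ⊤ (s e) (t e) →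
             ¬ Reach G F ⊤ (s x₀) (t x₀) → TriOrDibondAvoiding (F ∖ e)
  exchange F {e} {x₀} e∈F e-bridge a↛b = start (reach? ⊤ ⊤ (s e) a)
    where
    F′ : ESet G
    F′ = F ∖ e
    a b : Vertex
    a = s x₀
    b = t x₀
    lift : ∀ {u v} → Reach G F′ ⊤ u v → Reach G F ⊤ u v
    lift = reach-mono (∖-⊆ F e) (λ x∈ → x∈)
    e-in-F : Reach G F ⊤ (s e) (t e)
    e-in-F = reach-edge (c₁ refl refl) e∈F ∈⊤ ∈⊤
    start : Dec (Reach G ⊤ ⊤ (s e) a) → TriOrDibondAvoiding F′
    start (no e≁a) = two-separated F′ (reach-link e) (reach-link x₀) e-bridge (a↛b ∘′ lift) e≁a
    start (yes e~a) = cases (reach? F′ ⊤ (s e) a) (reach? F′ ⊤ (t e) a) (reach? F′ ⊤ (s e) b) (reach? F′ ⊤ (t e) b)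
      where
      cases : Dec (Reach G F′ ⊤ (s e) a) → Dec (Reach G F′ ⊤ (t e) a) → Dec (Reach G F′ ⊤ (s e) b) →
              Dec (Reach G F′ ⊤ (t e) b) → TriOrDibondAvoiding F′
      cases (no sa) (no ta) _ _ = three-separated F′ (reach-link e) e~a e-bridge sa ta
      cases _ _ (no sb) (no tb) = three-separated F′ (reach-link e) (reach-trans e~a (reach-link x₀)) e-bridge sb tb
      cases (yes sa) _ (yes sb) _ = ⊥-elim (a↛b (lift (reach-trans (reach-sym sa) sb)))
      cases _ (yes ta) _ (yes tb) = ⊥-elim (a↛b (lift (reach-trans (reach-sym ta) tb)))
      cases (yes sa) _ (no _) (yes tb) = ⊥-elim (a↛b (reach-trans (reach-trans (reach-sym (lift sa)) e-in-F) (lift tb)))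
      cases (no _) (yes ta) (yes sb) _ =
        ⊥-elim (a↛b (reach-trans (reach-trans (reach-sym (lift ta)) (reach-sym e-in-F)) (lift sb)))

module JoinMatroid (G : Graph) (L : ESet G → Set) (L-bonds : ∀ B → L B → IsBond G B) where

  open Graph G using () renaming (src to s; tgt to t)
  open Walks G
  open Components G
  open ComponentCount G
  open Tribonds G

  cut⊆Ext : ∀ {F X Y} → IsExt G F X → δ G Y ⊆ ∁ F → δ G Y ⊆ X
  cut⊆Ext isExt δY⊆∁F {g} g∈ = proj₂ (isExt g) λ r → connected-ends-∉δ δY⊆∁F r g∈

  bond⊆∁F⇒≡Ext : ∀ {F X B} → IsExt G F X → IsBond G X → IsBond G B → B ⊆ ∁ F → B ≡ X
  bond⊆∁F⇒≡Ext isExt (_ , _ , X-minimal) ((Y , refl) , B≠∅ , _) B⊆∁F =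
    ⊆-antisym (cut⊆Ext isExt B⊆∁F) (X-minimal _ (Y , refl) B≠∅ (cut⊆Ext isExt B⊆∁F))

  -- Every bond avoiding F equals X.  So an L-bond in ∁ F would be X, a tribond in ∁ F would have
  -- X inside each of its three cuts, and a dibond in ∁ F would be X with two new components.
  Ext-bond⇒independent : ∀ {F X} → IsExt G F X → IsBond G X → ¬ L X → JDualIndep G L (∁ F)
  Ext-bond⇒independent isExt bondX ¬LX _ (inj₁ (B , LB , refl)) sub =
    ¬LX (subst L (bond⊆∁F⇒≡Ext isExt bondX (L-bonds B LB) (drop-∷-⊆ sub)) LB)
  Ext-bond⇒independent isExt bondX ¬LX _ (inj₂ (inj₁ (_ , _ , _ , refl))) sub = inside⊈outside sub
  Ext-bond⇒independent {F} {X} isExt bondX ¬LX _ (inj₂ (inj₂ (_ , inj₁ (P , refl) , _ , refl))) sub =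
    δ-three-disjoint X₁#X₂ X₁#X₃ X₂#X₃
      (X⊆δ (joins⇒δ-nonempty join₁₂ X₁#X₂) (T⊆∁F ∘′ x∈p∪q⁺ ∘′ inj₁) x₀∈X)
      (X⊆δ (joins⇒δ-nonempty (joins-sym join₁₂) (disjoint-sym X₁#X₂)) (T⊆∁F ∘′ x∈p∪q⁺ ∘′ inj₂ ∘′ x∈p∪q⁺ ∘′ inj₁) x₀∈X)
      (X⊆δ (joins⇒δ-nonempty (joins-sym join₁₃) (disjoint-sym X₁#X₃)) (T⊆∁F ∘′ x∈p∪q⁺ ∘′ inj₂ ∘′ x∈p∪q⁺ ∘′ inj₂) x₀∈X)
    where
    open Tripartition P
    X₁#X₂ : Disjoint X₁ X₂
    X₁#X₂ = ∩≡⊥⇒disjoint disj₁₂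
    X₁#X₃ : Disjoint X₁ X₃
    X₁#X₃ = ∩≡⊥⇒disjoint disj₁₃
    X₂#X₃ : Disjoint X₂ X₃
    X₂#X₃ = ∩≡⊥⇒disjoint disj₂₃
    T⊆∁F : δ G X₁ ∪ (δ G X₂ ∪ δ G X₃) ⊆ ∁ F
    T⊆∁F = drop-∷-⊆ sub
    x₀∈X : proj₁ (proj₁ (proj₂ bondX)) ∈ X
    x₀∈X = proj₂ (proj₁ (proj₂ bondX))
    X⊆δ : ∀ {W} → Nonempty (δ G W) → δ G W ⊆ ∁ F → X ⊆ δ G W
    X⊆δ {W} δW≠∅ δW⊆∁F = proj₂ (proj₂ bondX) (δ G W) (W , refl) δW≠∅ (cut⊆Ext isExt δW⊆∁F)
  Ext-bond⇒independent {F} {X} isExt bondX ¬LX _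
    (inj₂ (inj₂ (_ , inj₂ ((B₁ , B₂ , (bond₁ , bond₂ , k , nc , nc′) , refl) , _) , _ , refl))) sub =
    bond-deletion-¬+2 bondX nc (subst (λ D → NumComp G (∁ D) (suc (suc k))) B₁∪B₂≡X nc′)
    where
    B₁∪B₂⊆∁F : B₁ ∪ B₂ ⊆ ∁ F
    B₁∪B₂⊆∁F = drop-∷-⊆ sub
    B₁≡X : B₁ ≡ X
    B₁≡X = bond⊆∁F⇒≡Ext isExt bondX bond₁ (B₁∪B₂⊆∁F ∘′ x∈p∪q⁺ ∘′ inj₁)
    B₂≡X : B₂ ≡ X
    B₂≡X = bond⊆∁F⇒≡Ext isExt bondX bond₂ (B₁∪B₂⊆∁F ∘′ x∈p∪q⁺ ∘′ inj₂)
    B₁∪B₂≡X : B₁ ∪ B₂ ≡ X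
    B₁∪B₂≡X = ⊆-antisym (∪-least (subst (_ ∈_) B₁≡X) (subst (_ ∈_) B₂≡X)) (x∈p∪q⁺ ∘′ inj₁ ∘′ subst (_ ∈_) (sym B₁≡X))

  -- A tribond or dibond containing no bond of L is itself a cocircuit.
  independent⇒¬tri/dibond : ∀ {D T} → JDualIndep G L D → T ⊆ D → ¬ (IsTribond G T ⊎ IsDibond G T)
  independent⇒¬tri/dibond ind T⊆D td =
    ind (outside ∷ _)
      (inj₂ (inj₂ (_ , td , (λ B LB B⊆T → ind (outside ∷ B) (inj₁ (B , LB , refl)) (out⊆ (T⊆D ∘′ B⊆T))) , refl)))
      (out⊆ T⊆D)

  independent⇒¬avoiding : ∀ {D F} → JDualIndep G L D → ∁ F ⊆ D → ¬ TriOrDibondAvoiding F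
  independent⇒¬avoiding ind ∁F⊆D (_ , td , T⊆∁F) = independent⇒¬tri/dibond ind (∁F⊆D ∘′ T⊆∁F) td

  -- Every cocircuit of J₀ other than B ∪ {e₀} is a union of cuts.
  independent-transfer : ∀ {F F′} → (∀ {K} → IsCut G K → K ⊆ ∁ F′ → K ⊆ ∁ F) →
                         JDualIndep G L (∁ F) → JDualIndep G L (∁ F′)
  independent-transfer cuts ind _ c@(inj₁ (B , LB , refl)) sub =
    ind _ c (out⊆ (cuts (proj₁ (L-bonds B LB)) (drop-∷-⊆ sub)))
  independent-transfer cuts ind _ (inj₂ (inj₁ (_ , _ , _ , refl))) sub = inside⊈outside sub
  independent-transfer {F′ = F′} cuts ind _ c@(inj₂ (inj₂ (_ , inj₁ (P , refl) , _ , refl))) sub =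
    ind _ c (out⊆ (∪-least (cuts (X₁ , refl) (T⊆ ∘′ x∈p∪q⁺ ∘′ inj₁))
                  (∪-least (cuts (X₂ , refl) (T⊆ ∘′ x∈p∪q⁺ ∘′ inj₂ ∘′ x∈p∪q⁺ ∘′ inj₁))
                           (cuts (X₃ , refl) (T⊆ ∘′ x∈p∪q⁺ ∘′ inj₂ ∘′ x∈p∪q⁺ ∘′ inj₂)))))
    where
    open Tripartition P
    T⊆ : δ G X₁ ∪ (δ G X₂ ∪ δ G X₃) ⊆ ∁ F′
    T⊆ = drop-∷-⊆ sub
  independent-transfer {F′ = F′} cuts ind _
    c@(inj₂ (inj₂ (_ , inj₂ ((B₁ , B₂ , (bond₁ , bond₂ , _) , refl) , _) , _ , refl))) sub =
    ind _ c (out⊆ (∪-least (cuts (proj₁ bond₁) (T⊆ ∘′ x∈p∪q⁺ ∘′ inj₁)) (cuts (proj₁ bond₂) (T⊆ ∘′ x∈p∪q⁺ ∘′ inj₂))))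
    where
    T⊆ : B₁ ∪ B₂ ⊆ ∁ F′
    T⊆ = drop-∷-⊆ sub

  forest-basis : ∀ {B X} → IsForest G B → IsExt G B X → IsBond G X → ¬ L X → JBasis G L B
  forest-basis {B} {X} forest isExt bondX ¬LX = independent , maximal
    where
    independent : JDualIndep G L (∁ B)
    independent = Ext-bond⇒independent isExt bondX ¬LX
    x₀-separated : ¬ Reach G B ⊤ (s (proj₁ (proj₁ (proj₂ bondX)))) (t (proj₁ (proj₁ (proj₂ bondX))))
    x₀-separated = proj₁ (isExt _) (proj₂ (proj₁ (proj₂ bondX)))
    maximal : ∀ D → JDualIndep G L D → ∁ B ⊆ D → D ⊆ ∁ B
    maximal D indD ∁B⊆D {e} e∈D with e ∈? B
    ... | no e∉B = x∉p⇒x∈∁p e∉B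
    ... | yes e∈B = ⊥-elim (independent⇒¬avoiding indD (∁∖⊆ ∁B⊆D e∈D) (exchange B e∈B (forest e e∈B) x₀-separated))

  module Basis {B : ESet G} (basis : JBasis G L B) where

    independent : JDualIndep G L (∁ B)
    independent = proj₁ basis

    maximal : ∀ D → JDualIndep G L D → ∁ B ⊆ D → D ⊆ ∁ B
    maximal = proj₂ basis

    -- Removing an edge e of a cycle does not create new cuts, so ∁ (B ∖ e) would still be independent.
    forest : IsForest G B
    forest e e∈B cycle = x∈∁p⇒x∉p (maximal _ (independent-transfer cuts independent) (∁-⊆-∁∖ B e) (∈∁∖ B e)) e∈B
      where
      cuts : ∀ {K} → IsCut G K → K ⊆ ∁ (B ∖ e) → K ⊆ ∁ B
      cuts (Y , refl) K⊆ {g} g∈ with g ∈? B | g ≟ e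
      ... | no g∉B | _ = x∉p⇒x∈∁p g∉B
      ... | yes g∈B | no g≢e = ⊥-elim (x∈∁p⇒x∉p (K⊆ g∈) (∈∖⁺ g∈B g≢e))
      ... | yes _ | yes refl = ⊥-elim (connected-ends-∉δ K⊆ cycle g∈)

    separated? : Decidable (λ g → ¬ Reach G B ⊤ (s g) (t g))
    separated? g = ¬? (reach? B ⊤ (s g) (t g))

    Ext : ESet G
    Ext = toSubset separated?

    Ext-isExt : IsExt G B Ext
    Ext-isExt g = ∈-toSubset⁻ separated? , ∈-toSubset⁺ separated?

    Ext⊆∁B : Ext ⊆ ∁ B
    Ext⊆∁B {g} g∈ = x∉p⇒x∈∁p λ g∈B → proj₁ (Ext-isExt g) g∈ (reach-edge (c₁ refl refl) g∈B ∈⊤ ∈⊤)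

    Ext-¬L : ¬ L Ext
    Ext-¬L LExt = independent (outside ∷ Ext) (inj₁ (Ext , LExt , refl)) (out⊆ Ext⊆∁B)

    no-avoiding : ¬ TriOrDibondAvoiding B
    no-avoiding = independent⇒¬avoiding independent (λ e∈ → e∈)

    -- With x₀ = ab in Ext, the B-classes of a and b cover the component of a (else a tribond
    -- or dibond would avoid B), and Ext is the cut between them.
    module NonemptyExt {x₀ : Edge} (x₀∈ : x₀ ∈ Ext) where

      a b : Vertex
      a = s x₀
      b = t x₀

      Y Z : VSet G
      Y = reachable B ⊤ a
      Z = reachable B ⊤ b

      a↛b : ¬ Reach G B ⊤ a b
      a↛b = proj₁ (Ext-isExt x₀) x₀∈

      Y#Z : Disjoint Y Z
      Y#Z x∈Y x∈Z = a↛b (reach-trans (∈reachable⁻ x∈Y) (reach-sym (∈reachable⁻ x∈Z)))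

      Y-or-Z : ∀ {w} → Reach G ⊤ ⊤ a w → w ∈ Y ⊎ w ∈ Z
      Y-or-Z {w} a~w with reach? B ⊤ a w | reach? B ⊤ b w
      ... | yes a→w | _ = inj₁ (∈reachable⁺ a→w)
      ... | no _ | yes b→w = inj₂ (∈reachable⁺ b→w)
      ... | no a↛w | no b↛w = ⊥-elim (no-avoiding (three-separated B (reach-link x₀) a~w a↛b a↛w b↛w))

      leaveY : ∀ {e} → Cross (_∈ Y) (_∉ Y) e → Cross (_∈ Y) (_∈ Z) e
      leaveY {e} (c₁ s∈Y t∉Y) with Y-or-Z (reach-trans (reach-mono ⊆⊤ (λ x∈ → x∈) (∈reachable⁻ s∈Y)) (reach-link e))
      ... | inj₁ t∈Y = ⊥-elim (t∉Y t∈Y)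
      ... | inj₂ t∈Z = c₁ s∈Y t∈Z
      leaveY {e} (c₂ s∉Y t∈Y)
        with Y-or-Z (reach-trans (reach-mono ⊆⊤ (λ x∈ → x∈) (∈reachable⁻ t∈Y)) (reach-sym (reach-link e)))
      ... | inj₁ s∈Y = ⊥-elim (s∉Y s∈Y)
      ... | inj₂ s∈Z = c₂ s∈Z t∈Y

      Ext⊆δY : Ext ⊆ δ G Y
      Ext⊆δY {g} g∈ with reach? ⊤ ⊤ a (s g)
      ... | no a≁g = ⊥-elim (no-avoiding (two-separated B (reach-link x₀) (reach-link g) a↛b g-separated a≁g))
        where
        g-separated : ¬ Reach G B ⊤ (s g) (t g)
        g-separated = proj₁ (Ext-isExt g) g∈
      ... | yes a~g with Y-or-Z a~g | Y-or-Z (reach-trans a~g (reach-link g))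
      ...   | inj₁ s∈Y | inj₂ t∈Z = ∈δ⁺ (c₁ s∈Y λ t∈Y → Y#Z t∈Y t∈Z)
      ...   | inj₂ s∈Z | inj₁ t∈Y = ∈δ⁺ (c₂ (λ s∈Y → Y#Z s∈Y s∈Z) t∈Y)
      ...   | inj₁ s∈Y | inj₁ t∈Y =
        ⊥-elim (proj₁ (Ext-isExt g) g∈ (reach-trans (reach-sym (∈reachable⁻ s∈Y)) (∈reachable⁻ t∈Y)))
      ...   | inj₂ s∈Z | inj₂ t∈Z =
        ⊥-elim (proj₁ (Ext-isExt g) g∈ (reach-trans (reach-sym (∈reachable⁻ s∈Z)) (∈reachable⁻ t∈Z)))

      δY⊆Ext : δ G Y ⊆ Ext
      δY⊆Ext {g} g∈ = proj₂ (Ext-isExt g) λ r → connected-ends-∉δ δY⊆∁B r g∈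
        where
        δY⊆∁B : δ G Y ⊆ ∁ B
        δY⊆∁B e∈ = x∉p⇒x∈∁p λ e∈B → reachable-closed e∈B ∈⊤ ∈⊤ e∈

      Ext≡δY : Ext ≡ δ G Y
      Ext≡δY = ⊆-antisym Ext⊆δY δY⊆Ext

      δY-isBond : IsBond G (δ G Y)
      δY-isBond = isBond-δ Y Z Y#Z reachable-conn reachable-conn (c₁ (∈reachable⁺ (here ∈⊤)) (∈reachable⁺ (here ∈⊤))) leaveY

    Ext-isBond : Nonempty Ext → IsBond G Ext
    Ext-isBond (_ , x₀∈) = subst (IsBond G) (sym Ext≡δY) δY-isBond
      where open NonemptyExt x₀∈

-- When B spans every component, linearity of L forces every bond into L.
module Spanning (G : Graph) (L : ESet G → Set) (lin : IsLinearClass G L) {B : ESet G} (basis : JBasis G L B) where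

  open Graph G using () renaming (src to s; tgt to t)
  open Walks G
  open Components G
  open Splitting G
  open Tribonds G
  open JoinMatroid G L (proj₁ lin)
  open Basis basis

  module _ (spanning : Empty Ext) where

    span-edge : (g : Edge) → Reach G B ⊤ (s g) (t g)
    span-edge g with reach? B ⊤ (s g) (t g)
    ... | yes r = r
    ... | no g-separated = ⊥-elim (spanning (g , proj₂ (Ext-isExt g) g-separated))

    span : ∀ {u v} → Reach G ⊤ ⊤ u v → Reach G B ⊤ u v
    span (here u∈) = here u∈
    span (step r ab) = reach-trans (span r) (along (adj-ends ab))
      where
      along : ∀ {y z g} → Ends y z g → Reach G B ⊤ y z
      along {g = g} (c₁ refl refl) = span-edge g
      along {g = g} (c₂ refl refl) = reach-sym (span-edge g)

    module FundamentalCut {e : Edge} (e∈B : e ∈ B) where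

      P Q : VSet G
      P = reachable (B ∖ e) ⊤ (s e)
      Q = reachable (B ∖ e) ⊤ (t e)

      P#Q : Disjoint P Q
      P#Q x∈P x∈Q = forest e e∈B (reach-trans (∈reachable⁻ x∈P) (reach-sym (∈reachable⁻ x∈Q)))

      P-or-Q : ∀ {v} → Reach G ⊤ ⊤ (s e) v → v ∈ P ⊎ v ∈ Q
      P-or-Q r with reach⇒via ∈⇒∈∖⊎≡ (span r)
      ... | inj₁ r′ = inj₁ (∈reachable⁺ r′)
      ... | inj₂ (inj₁ (_ , q)) = inj₂ (∈reachable⁺ q)
      ... | inj₂ (inj₂ (cycle , _)) = ⊥-elim (forest e e∈B cycle)

      δP⊆∁B∖e : δ G P ⊆ ∁ (B ∖ e)
      δP⊆∁B∖e g∈ = x∉p⇒x∈∁p λ g∈B∖e → reachable-closed g∈B∖e ∈⊤ ∈⊤ g∈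

      δP-isExt : IsExt G (B ∖ e) (δ G P)
      δP-isExt g = (λ g∈ r → connected-ends-∉δ δP⊆∁B∖e r g∈) , separated⇒∈δP
        where
        separated⇒∈δP : ¬ Reach G (B ∖ e) ⊤ (s g) (t g) → g ∈ δ G P
        separated⇒∈δP g-separated with reach⇒via ∈⇒∈∖⊎≡ (span-edge g)
        ... | inj₁ r = ⊥-elim (g-separated r)
        ... | inj₂ (inj₁ (p , q)) = ∈δ⁺ (c₁ (∈reachable⁺ (reach-sym p)) (λ t∈P → P#Q t∈P (∈reachable⁺ q)))
        ... | inj₂ (inj₂ (p , q)) = ∈δ⁺ (c₂ (λ s∈P → P#Q s∈P (∈reachable⁺ (reach-sym p))) (∈reachable⁺ q))

      δP-isBond : IsBond G (δ G P)
      δP-isBond = isBond-δ P Q P#Q reachable-conn reachable-conn (c₁ (∈reachable⁺ (here ∈⊤)) (∈reachable⁺ (here ∈⊤))) leaveP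
        where
        from-s : ∀ {x} → x ∈ P → Reach G ⊤ ⊤ (s e) x
        from-s x∈ = reach-mono ⊆⊤ (λ z → z) (∈reachable⁻ x∈)
        leaveP : ∀ {g} → Cross (_∈ P) (_∉ P) g → Cross (_∈ P) (_∈ Q) g
        leaveP {g} (c₁ s∈P t∉P) with P-or-Q (reach-trans (from-s s∈P) (reach-link g))
        ... | inj₁ t∈P = ⊥-elim (t∉P t∈P)
        ... | inj₂ t∈Q = c₁ s∈P t∈Q
        leaveP {g} (c₂ s∉P t∈P) with P-or-Q (reach-trans (from-s t∈P) (reach-sym (reach-link g)))
        ... | inj₁ s∈P = ⊥-elim (s∉P s∈P)
        ... | inj₂ s∈Q = c₂ s∈Q t∈P

      δP-¬¬L : ¬ ¬ L (δ G P)
      δP-¬¬L ¬L = x∈∁p⇒x∉p (maximal _ (Ext-bond⇒independent δP-isExt δP-isBond ¬L) (∁-⊆-∁∖ B e) (∈∁∖ B e)) e∈B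

    Minimal : VSet G → Set
    Minimal Y = ∀ B′ → IsCut G B′ → Nonempty B′ → B′ ⊆ δ G Y → δ G Y ⊆ B′

    Smaller : ESet G → Set
    Smaller B′ = ∀ B″ → ∣ B″ ∩ B ∣ < ∣ B′ ∩ B ∣ → IsBond G B″ → ¬ ¬ L B″

    -- If e is the only edge of B in the bond δ Y, then δ Y is the fundamental cut of e.
    one-crossing : ∀ {Y e} → Minimal Y → e ∈ B → e ∈ δ G Y → (∀ {g} → g ∈ δ G Y → g ∈ B → g ≡ e) → ¬ ¬ L (δ G Y)
    one-crossing {Y} {e} minimal e∈B e∈δY only-e = subst (λ D → ¬ ¬ L D) (sym δY≡δP) δP-¬¬L
      where
      open FundamentalCut e∈B
      B∖e-avoids-δY : ∀ {h} → h ∈ B ∖ e → h ∉ δ G Y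
      B∖e-avoids-δY h∈ h∈δ = proj₂ (∈∖⁻ h∈) (only-e h∈δ (proj₁ (∈∖⁻ h∈)))
      stays : ∀ {x y} → Reach G (B ∖ e) ⊤ x y → x ∈ Y → y ∈ Y
      stays = reach-stays Y B∖e-avoids-δY
      δP⊆δY : δ G P ⊆ δ G Y
      δP⊆δY {g} g∈ with cross-ends (∈δ⁻ g∈)
      ... | p , q , p∈P , q∉P , pq
        with P-or-Q (reach-trans (reach-mono ⊆⊤ (λ z → z) (∈reachable⁻ p∈P)) (reach-edge pq ∈⊤ ∈⊤ ∈⊤))
      ...   | inj₁ q∈P = ⊥-elim (q∉P q∈P)
      ...   | inj₂ q∈Q = ∈δ⁺ (orient (∈δ⁻ e∈δY))
        where
        orient : Cross (_∈ Y) (_∉ Y) e → Cross (_∈ Y) (_∉ Y) g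
        orient (c₁ s∈ t∉) =
          ends-cross pq (stays (∈reachable⁻ p∈P) s∈) (λ q∈Y → t∉ (stays (reach-sym (∈reachable⁻ q∈Q)) q∈Y))
        orient (c₂ s∉ t∈) =
          cross-sym (ends-cross pq (λ p∈Y → s∉ (stays (reach-sym (∈reachable⁻ p∈P)) p∈Y)) (stays (∈reachable⁻ q∈Q) t∈))
      δY≡δP : δ G Y ≡ δ G P
      δY≡δP = ⊆-antisym (minimal (δ G P) (P , refl) (proj₁ (proj₂ δP-isBond)) δP⊆δY) δP⊆δY

    -- K and K′ lie on the two sides of the bond B′ = δ K = δ K′, and e, f ∈ B cross it.  If the
    -- ends of e and f in K are not joined by edges of B outside B′, splitting K between them
    -- gives a tripartition (X₁, K′, X₂) whose bonds δ X₁ and δ X₂ meet B in fewer edges.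
    module TriangleStep {K K′ : VSet G} {B′ : ESet G} (K#K′ : Disjoint K K′) (connK : Conn K) (connK′ : Conn K′)
      (δK≡B′ : δ G K ≡ B′) (δK′≡B′ : δ G K′ ≡ B′)
      {e f : Edge} {yE zE yF zF : Vertex} (e-ends : Ends yE zE e) (f-ends : Ends yF zF f)
      (yE∈K : yE ∈ K) (zE∈K′ : zE ∈ K′) (yF∈K : yF ∈ K) (zF∈K′ : zF ∈ K′) (e∈B : e ∈ B) (f∈B : f ∈ B)
      (apart : ¬ Reach G (B ∩ ∁ B′) K yE yF) (IH : Smaller B′) where

      private
        C : VSet G
        C = K ∪ K′

        crossing-K : ∀ {g y z} → Ends y z g → y ∈ K → z ∈ K′ → g ∈ B′
        crossing-K yz y∈K z∈K′ = subst (_ ∈_) δK≡B′ (∈δ⁺ (ends-cross yz y∈K (λ z∈K → K#K′ z∈K z∈K′)))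

        isoC : Isolated C
        isoC {g} g∈ with cross-ends (∈δ⁻ g∈)
        ... | y , z , y∈C , z∉C , yz with ∈∪⁻ y∈C
        ...   | inj₁ y∈K = ends-∉δ yz (λ y∈K′ → K#K′ y∈K y∈K′) (z∉C ∘′ q⊆p∪q K K′)
                             (subst (_ ∈_) (trans δK≡B′ (sym δK′≡B′)) (∈δ⁺ (ends-cross yz y∈K (z∉C ∘′ p⊆p∪q K′))))
        ...   | inj₂ y∈K′ = ends-∉δ yz (λ y∈K → K#K′ y∈K y∈K′) (z∉C ∘′ p⊆p∪q K′)
                             (subst (_ ∈_) (trans δK′≡B′ (sym δK≡B′)) (∈δ⁺ (ends-cross yz y∈K′ (z∉C ∘′ q⊆p∪q K K′))))

        sp : Split K (B ∩ ∁ B′) yE yF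
        sp = split connK yE∈K yF∈K apart
        open Split sp

        jX₁K′ : Cross (_∈ X₁) (_∈ K′) e
        jX₁K′ = ends-cross e-ends u∈X₁ zE∈K′
        jK′X₂ : Cross (_∈ K′) (_∈ X₂) f
        jK′X₂ = cross-sym (ends-cross f-ends v∈X₂ zF∈K′)

        parts : ThreeParts C X₁ K′ X₂
        parts = record
          { isoC = isoC ; connC = conn-∪ connK connK′ (ends-cross e-ends yE∈K zE∈K′)
          ; cover = λ x∈C → [ (λ x∈K → [ inj₁ , inj₂ ∘′ inj₂ ]′ (cover x∈K)) , inj₂ ∘′ inj₁ ]′ (∈∪⁻ x∈C)
          ; A⊆C = p⊆p∪q K′ ∘′ X₁⊆S ; M⊆C = q⊆p∪q K K′ ; B⊆C = p⊆p∪q K′ ∘′ X₂⊆S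
          ; A#M = K#K′ ∘′ X₁⊆S ; A#B = X₁#X₂ ; M#B = λ x∈K′ x∈X₂ → K#K′ (X₂⊆S x∈X₂) x∈K′
          ; connA = conn₁ ; connM = connK′ ; connB = conn₂ ; a∈A = u∈X₁ ; m∈M = zE∈K′ ; b∈B = v∈X₂ }

        -- δ W ∩ B ⊆ B′ ∩ B, and h ∈ B′ ∩ B has no end in W.
        smaller : ∀ {W W′ h yH zH} → W ⊆ K → (∀ {x} → x ∈ K → x ∉ W → x ∈ W′) →
                  (∀ {g} → g ∈ B ∩ ∁ B′ → ¬ Cross (_∈ W) (_∈ W′) g) →
                  Ends yH zH h → yH ∉ W → zH ∉ W → h ∈ B′ → h ∈ B → ∣ δ G W ∩ B ∣ < ∣ B′ ∩ B ∣
        smaller {W} {W′} W⊆K to-W′ no-F-edge-W hyz yH∉ zH∉ h∈B′ h∈B =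
          p⊂q⇒∣p∣<∣q∣ (sub , _ , x∈p∩q⁺ (h∈B′ , h∈B) , λ h∈ → ends-∉δ hyz yH∉ zH∉ (proj₁ (∈∩⁻ h∈)))
          where
          sub : δ G W ∩ B ⊆ B′ ∩ B
          sub {g} g∈ with ∈∩⁻ g∈
          ... | g∈δW , g∈B with cross-ends (leave-isolated isoC (p⊆p∪q K′ ∘′ W⊆K) (∈δ⁻ g∈δW))
          ...   | y , z , y∈W , (z∉W , z∈C) , yz with ∈∪⁻ z∈C | g ∈? B′
          ...     | inj₂ z∈K′ | _ = x∈p∩q⁺ (crossing-K yz (W⊆K y∈W) z∈K′ , g∈B)
          ...     | inj₁ _ | yes g∈B′ = x∈p∩q⁺ (g∈B′ , g∈B)
          ...     | inj₁ z∈K | no g∉B′ =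
            ⊥-elim (no-F-edge-W (x∈p∩q⁺ (g∈B , x∉p⇒x∈∁p g∉B′)) (ends-cross yz y∈W (to-W′ z∈K z∉W)))

        K′#X₁ : Disjoint K′ X₁
        K′#X₁ x∈K′ x∈X₁ = K#K′ (X₁⊆S x∈X₁) x∈K′
        K′#X₂ : Disjoint K′ X₂
        K′#X₂ x∈K′ x∈X₂ = K#K′ (X₂⊆S x∈X₂) x∈K′

        |δX₁∩B|< : ∣ δ G X₁ ∩ B ∣ < ∣ B′ ∩ B ∣
        |δX₁∩B|< = smaller X₁⊆S (λ x∈K x∉ → to₂ x∈K x∉) no-F-edge f-ends (disjoint-sym X₁#X₂ v∈X₂) (K′#X₁ zF∈K′)
                     (crossing-K f-ends yF∈K zF∈K′) f∈B
        |δX₂∩B|< : ∣ δ G X₂ ∩ B ∣ < ∣ B′ ∩ B ∣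
        |δX₂∩B|< = smaller X₂⊆S (λ x∈K x∉ → to₁ x∈K x∉) (λ g∈ → no-F-edge g∈ ∘′ cross-sym) e-ends (X₁#X₂ u∈X₁) (K′#X₂ zE∈K′)
                     (crossing-K e-ends yE∈K zE∈K′) e∈B

      result : ¬ ¬ L B′
      result ¬LB′ =
        IH _ |δX₁∩B|< (ThreeParts.δA-isBond parts jX₁K′ jK′X₂) λ L₁ →
        IH _ |δX₂∩B|< (ThreeParts.δB-isBond parts jX₁K′ jK′X₂) λ L₂ →
        proj₂ lin (ThreeParts.tripartition parts jX₁K′ (proj₂ (joining-edge connK)) jK′X₂)
          (inj₂ (inj₁ (L₁ , subst (λ D → ¬ L D) (sym δK′≡B′) ¬LB′ , L₂)))

    -- Two edges e ≠ f of B in the bond δ Y: let K and K′ be the components of G[Y] and G[∁ Y]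
    -- containing the ends of e; by minimality δ K = δ Y = δ K′.  A triangle step applies on one
    -- side, since otherwise e would lie on a cycle of B through f.
    module TwoCrossings {Y : VSet G} (minimal : Minimal Y) (IH : Smaller (δ G Y)) {e f : Edge} (e∈B : e ∈ B) (f∈B : f ∈ B)
      (e∈δY : e ∈ δ G Y) (f∈δY : f ∈ δ G Y) (f≢e : f ≢ e)
      {yE zE : Vertex} (yE∈Y : yE ∈ Y) (zE∉Y : zE ∉ Y) (e-ends : Ends yE zE e) where

      K K′ : VSet G
      K = reachable ⊤ Y yE
      K′ = reachable ⊤ (∁ Y) zE

      K#K′ : Disjoint K K′
      K#K′ x∈K x∈K′ = x∈∁p⇒x∉p (reachable-⊆ x∈K′) (reachable-⊆ x∈K)

      yE∈K : yE ∈ K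
      yE∈K = ∈reachable⁺ (here yE∈Y)
      zE∈K′ : zE ∈ K′
      zE∈K′ = ∈reachable⁺ (here (x∉p⇒x∈∁p zE∉Y))

      δK⊆δY : δ G K ⊆ δ G Y
      δK⊆δY = δ-reachable⊆δ

      δK′⊆δY : δ G K′ ⊆ δ G Y
      δK′⊆δY = ∈δ∁⇒∈δ ∘′ δ-reachable⊆δ

      δK≡δY : δ G K ≡ δ G Y
      δK≡δY = ⊆-antisym δK⊆δY (minimal (δ G K) (K , refl) (e , e∈δK) δK⊆δY)
        where
        e∈δK : e ∈ δ G K
        e∈δK = ∈δ⁺ (ends-cross e-ends yE∈K (zE∉Y ∘′ reachable-⊆))

      δK′≡δY : δ G K′ ≡ δ G Y
      δK′≡δY = ⊆-antisym δK′⊆δY (minimal (δ G K′) (K′ , refl) (e , e∈δK′) δK′⊆δY)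
        where
        e∈δK′ : e ∈ δ G K′
        e∈δK′ = ∈δ⁺ (ends-cross (ends-sym e-ends) zE∈K′ (λ yE∈K′ → x∈∁p⇒x∉p (reachable-⊆ yE∈K′) yE∈Y))

      F″ : ESet G
      F″ = B ∩ ∁ (δ G Y)

      lift : ∀ {X u v} → Reach G F″ X u v → Reach G (B ∖ e) ⊤ u v
      lift = reach-mono (λ h∈ → ∈∖⁺ (proj₁ (∈∩⁻ h∈)) λ { refl → x∈∁p⇒x∉p (proj₂ (∈∩⁻ h∈)) e∈δY }) ⊆⊤

      with-f : (∃₂ λ y z → y ∈ K × z ∉ K × Ends y z f) → ¬ ¬ L (δ G Y)
      with-f (yF , zF , yF∈K , _ , f-ends) = decide (reach? F″ K yE yF) (reach? F″ K′ zE zF)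
        where
        zF∈K′ : zF ∈ K′
        zF∈K′ = ends-∈δ-other f-ends (subst (f ∈_) (sym δK′≡δY) f∈δY) (λ yF∈K′ → K#K′ yF∈K yF∈K′)
        decide : Dec (Reach G F″ K yE yF) → Dec (Reach G F″ K′ zE zF) → ¬ ¬ L (δ G Y)
        decide (no apart) _ =
          TriangleStep.result K#K′ reachable-conn reachable-conn δK≡δY δK′≡δY
            e-ends f-ends yE∈K zE∈K′ yF∈K zF∈K′ e∈B f∈B apart IH
        decide (yes _) (no apart) =
          TriangleStep.result (disjoint-sym K#K′) reachable-conn reachable-conn δK′≡δY δK≡δY
            (ends-sym e-ends) (ends-sym f-ends) zE∈K′ yE∈K zF∈K′ yF∈K e∈B f∈B apart IH
        decide (yes yE→yF) (yes zE→zF) _ =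
          forest e e∈B (reach-between-ends e-ends
            (reach-trans (lift yE→yF) (reach-trans (reach-edge f-ends (∈∖⁺ f∈B f≢e) ∈⊤ ∈⊤) (reach-sym (lift zE→zF)))))

      result : ¬ ¬ L (δ G Y)
      result = with-f (cross-ends (∈δ⁻ (subst (f ∈_) (sym δK≡δY) f∈δY)))

    two-crossings : ∀ {Y e f} → Minimal Y → Smaller (δ G Y) → e ∈ B → f ∈ B → e ∈ δ G Y → f ∈ δ G Y → f ≢ e →
                    ¬ ¬ L (δ G Y)
    two-crossings minimal IH e∈B f∈B e∈δY f∈δY f≢e =
      let (_ , _ , yE∈Y , zE∉Y , e-ends) = cross-ends (∈δ⁻ e∈δY) in
      TwoCrossings.result minimal IH e∈B f∈B e∈δY f∈δY f≢e yE∈Y zE∉Y e-ends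

    bonds-¬¬L-< : ∀ n B′ → ∣ B′ ∩ B ∣ < n → IsBond G B′ → ¬ ¬ L B′
    bonds-¬¬L-< (suc n) _ |B′∩B|<n ((Y , refl) , (e′ , e′∈) , minimal) with cross-ends (∈δ⁻ e′∈)
    ... | y , z , y∈Y , z∉Y , yz with exit Y (span (reach-edge yz ∈⊤ ∈⊤ ∈⊤)) y∈Y z∉Y
    ...   | e , e∈B , e∈δY , _ with any? (λ f → f ∈? δ G Y ×-dec f ∈? B ×-dec ¬? (f ≟ e))
    ...     | yes (f , f∈δY , f∈B , f≢e) = two-crossings minimal IH e∈B f∈B e∈δY f∈δY f≢e
      where
      IH : Smaller (δ G Y)
      IH B″ lt = bonds-¬¬L-< n B″ (ℕ.<-≤-trans lt (ℕ.≤-pred |B′∩B|<n))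
    ...     | no only-e = one-crossing minimal e∈B e∈δY only-e′
      where
      only-e′ : ∀ {g} → g ∈ δ G Y → g ∈ B → g ≡ e
      only-e′ {g} g∈δY g∈B with g ≟ e
      ... | yes g≡e = g≡e
      ... | no g≢e = ⊥-elim (only-e (g , g∈δY , g∈B , g≢e))

    bonds-¬¬L : ∀ B′ → IsBond G B′ → ¬ ¬ L B′
    bonds-¬¬L B′ = bonds-¬¬L-< (suc ∣ B′ ∩ B ∣) B′ (ℕ.n<1+n _)

    -- L is an arbitrary predicate, so each bond is only shown to be in L up to double negation;
    -- as there are finitely many edge sets, this still contradicts non-triviality.
    L-trivial : ¬ NonTrivial G L
    L-trivial nonTrivial = ¬¬-shift-Subset (λ B′ → IsBond G B′ → L B′) bond⇒¬¬L nonTrivial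
      where
      bond⇒¬¬L : ∀ B′ → ¬ ¬ (IsBond G B′ → L B′)
      bond⇒¬¬L B′ k = k λ bondB′ → ⊥-elim (bonds-¬¬L B′ bondB′ (λ LB′ → k λ _ → LB′))

  Ext-nonempty : NonTrivial G L → Nonempty Ext
  Ext-nonempty nonTrivial with nonempty? Ext
  ... | yes Ext≠∅ = Ext≠∅
  ... | no Ext≡∅ = ⊥-elim (L-trivial Ext≡∅ nonTrivial)

theorem3p4 : (G : Graph) (L : Subset (nE G) → Set) →
    IsLinearClass G L → NonTrivial G L →
    (B : Subset (nE G)) →
    JBasis G L B ⇔
    (IsForest G B × Σ (Subset (nE G)) λ X → IsExt G B X × IsBond G X × ¬ L X)
theorem3p4 G L lin nonTrivial B = mk⇔ basis⇒forest forest⇒basis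
  where
  open JoinMatroid G L (proj₁ lin)
  basis⇒forest : JBasis G L B → IsForest G B × Σ (Subset (nE G)) λ X → IsExt G B X × IsBond G X × ¬ L X
  basis⇒forest basis = forest , Ext , Ext-isExt , Ext-isBond (Spanning.Ext-nonempty G L lin basis nonTrivial) , Ext-¬L
    where open Basis basis
  forest⇒basis : (IsForest G B × Σ (Subset (nE G)) λ X → IsExt G B X × IsBond G X × ¬ L X) → JBasis G L B
  forest⇒basis (forest , X , isExt , bondX , ¬LX) = forest-basis forest isExt bondX ¬LX
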